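{- Let $n\geqslant 5$, let $\Omega=\{1,\dots,n\}$, let $G=\mathrm{S}_n$ or $\mathrm{A}_n$ acting naturally on $\Omega$, and let $H$ be a subgroup of $G$ with odd index $|G:H|>1$. Suppose that $H$ normalizes a subgroup $L=\mathrm{Sym}(\Delta_1)\times\cdots\times\mathrm{Sym}(\Delta_t)$ of $\mathrm{S}_n$, where $t\geqslant 2$ and $\Delta_1,\dots,\Delta_t$ form a partition of $\Omega$. Then (1) $|(L\cap G):(L\cap H)|$ is odd, and $|(L\cap G)^{\Delta_i}:(L\cap H)^{\Delta_i}|$ is odd for each $1\leqslant i\leqslant t$; (2) each composition factor of $L\cap H$ is a composition factor of $(L\cap H)^{\Delta_i}$ for some $i$.
   Context: $\mathrm{Sym}(\Delta_i)$ is identified with the subgroup of $\mathrm{S}_n$ fixing every point outside $\Delta_i$. For a subgroup $X\leqslant\mathrm{S}_n$ fixing a subset $\Delta\subseteq\Omega$ setwise, $X^\Delta$ denotes the permutation group induced by $X$ on $\Delta$. -}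

module Defs where

open import Data.Nat as ℕ using (ℕ; zero; suc; _*_; _<_)
open import Data.Bool using (Bool; true; false; T; _∧_; _∨_; not; if_then_else_)
open import Data.Fin as Fin using (Fin)
open import Data.Fin.Properties using () renaming (_≟_ to _≟F_; _<?_ to _<?F_)
open import Data.Vec as Vec using (Vec; []; _∷_; lookup; tabulate)
open import Data.Vec.Properties using (≡-dec)
open import Data.List as List using (List; length; filterᵇ; cartesianProduct; allFin; concatMap)
open import Data.Bool.ListAction using (all; any)
open import Data.Product using (Σ; ∃; _×_; _,_)
open import Data.Sum using (_⊎_)
open import Relation.Nullary using (¬_)
open import Relation.Nullary.Decidable using (⌊_⌋)
open import Relation.Binary.PropositionalEquality using (_≡_)

-- Maps Ω → Ω, Ω = Fin n, written as tables (vectors of images).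

Arr : ℕ → Set
Arr n = Vec (Fin n) n

_≟A_ : ∀ {n} (v w : Arr n) → Bool
v ≟A w = ⌊ ≡-dec _≟F_ v w ⌋

_∘ₚ_ : ∀ {n} → Arr n → Arr n → Arr n
v ∘ₚ w = tabulate (λ i → lookup v (lookup w i))

idₚ : ∀ {n} → Arr n
idₚ = tabulate (λ i → i)

pairs : (n : ℕ) → List (Fin n × Fin n)
pairs n = cartesianProduct (allFin n) (allFin n)

-- v is a permutation (injective, hence bijective, map Ω → Ω)
isPerm : ∀ {n} → Arr n → Bool
isPerm {n} v = all (λ { (i , j) → not ⌊ lookup v i ≟F lookup v j ⌋ ∨ ⌊ i ≟F j ⌋ }) (pairs n)

inversions : ∀ {n} → Arr n → ℕ
inversions {n} v = length (filterᵇ (λ { (i , j) → ⌊ i <?F j ⌋ ∧ ⌊ lookup v j <?F lookup v i ⌋ }) (pairs n))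

Even Odd : ℕ → Set
Even m = ∃ λ k → m ≡ 2 * k
Odd m = ∃ λ k → m ≡ suc (2 * k)

allVecs : ∀ {n} (k : ℕ) → List (Vec (Fin n) k)
allVecs zero = List.[ [] ]
allVecs {n} (suc k) = concatMap (λ x → List.map (x ∷_) (allVecs k)) (allFin n)

allArr : ∀ n → List (Arr n)
allArr n = allVecs n

Sub : ℕ → Set
Sub n = Arr n → Bool

_∈_ : ∀ {n} → Arr n → Sub n → Set
v ∈ S = T (S v)

_⊆_ : ∀ {n} → Sub n → Sub n → Set
S ⊆ R = ∀ v → v ∈ S → v ∈ R

_∩_ : ∀ {n} → Sub n → Sub n → Sub n
(S ∩ R) v = S v ∧ R v

card : ∀ {n} → Sub n → ℕ
card {n} S = length (filterᵇ S (allArr n))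

-- S is a subgroup of Sym(Ω) = S_n : a nonempty set of permutations closed
-- under composition (for finite sets this is exactly a subgroup).
IsPermGroup : ∀ {n} → Sub n → Set
IsPermGroup S = (∀ v → v ∈ S → T (isPerm v)) × idₚ ∈ S
              × (∀ v w → v ∈ S → w ∈ S → (v ∘ₚ w) ∈ S)

Symₙ : ∀ n → Sub n
Symₙ n v = isPerm v

Altₙ : ∀ n → Sub n
Altₙ n v = isPerm v ∧ ⌊ ℕ._≟_ (inversions v ℕ.% 2) 0 ⌋

data Kind : Set where
  symmetric alternating : Kind

groupOf : Kind → ∀ n → Sub n
groupOf symmetric n = Symₙ n
groupOf alternating n = Altₙ n

HasIndex : ∀ {n} → Sub n → Sub n → ℕ → Set
HasIndex A B m = card A ≡ m * card B

OddIndex : ∀ {n} → Sub n → Sub n → Set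
OddIndex A B = ∃ λ m → HasIndex A B m × Odd m

-- X normalizes Y : x Y x⁻¹ ⊆ Y for all x ∈ X, i.e. x Y ⊆ Y x.
Normalizes : ∀ {n} → Sub n → Sub n → Set
Normalizes X Y = ∀ x y → x ∈ X → y ∈ Y → ∃ λ y' → y' ∈ Y × (x ∘ₚ y) ≡ (y' ∘ₚ x)

-- Partitions Ω = Δ₁ ⊔ … ⊔ Δₜ, given by the block map  part : Ω → {1..t}
-- (Δ i = part⁻¹(i)), with every block nonempty.

IsPartition : ∀ {n t} → (Fin n → Fin t) → Set
IsPartition part = ∀ i → ∃ λ x → part x ≡ i

-- L = Sym(Δ₁) × ⋯ × Sym(Δₜ) ≤ S_n : the permutations mapping each Δᵢ to itself.
YoungSub : ∀ {n t} → (Fin n → Fin t) → Sub n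
YoungSub {n} part v =
  isPerm v ∧ all (λ x → ⌊ part (lookup v x) ≟F part x ⌋) (allFin n)

-- the permutation of Sym(Δᵢ) (fixing Ω ∖ Δᵢ pointwise) induced by v on Δᵢ
restrict : ∀ {n t} → (Fin n → Fin t) → Fin t → Arr n → Arr n
restrict part i v = tabulate (λ x → if ⌊ part x ≟F i ⌋ then lookup v x else x)

-- X^{Δᵢ}, realised inside Sym(Δᵢ) ≤ S_n
induced : ∀ {n t} → (Fin n → Fin t) → Fin t → Sub n → Sub n
induced {n} part i X w = any (λ x → X x ∧ (restrict part i x ≟A w)) (allArr n)

IsNormalIn : ∀ {n} → Sub n → Sub n → Set
IsNormalIn N A = IsPermGroup N × N ⊆ A
  × (∀ a x → a ∈ A → x ∈ N → ∃ λ x' → x' ∈ N × (a ∘ₚ x) ≡ (x' ∘ₚ a))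

MaxNormal : ∀ {n} → Sub n → Sub n → Set
MaxNormal B A = IsNormalIn B A × (∃ λ a → a ∈ A × ¬ (a ∈ B))
  × (∀ N → IsNormalIn N A → B ⊆ N → (N ⊆ B ⊎ A ⊆ N))

IsTrivial : ∀ {n} → Sub n → Set
IsTrivial X = ∀ v → v ∈ X → v ≡ idₚ

data CompSeries {n} (X : Sub n) : Set where
  done : IsTrivial X → CompSeries X
  step : (Y : Sub n) → MaxNormal Y X → CompSeries Y → CompSeries X

-- CompFactor X A B : A/B is a factor Xⱼ/Xⱼ₊₁ of some composition series of X
data CompFactor {n} (X : Sub n) : Sub n → Sub n → Set where
  here  : ∀ {B} → MaxNormal B X → CompSeries B → CompFactor X X B
  there : ∀ {Y A B} → MaxNormal Y X → CompFactor Y A B → CompFactor X A B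

-- A/B ≅ C/D  (for B ⊴ A, D ⊴ C): there is a map f : A → C such that
-- a ↦ f(a)D is a surjective homomorphism A → C/D with kernel B.
QuotIso : ∀ {n} → Sub n → Sub n → Sub n → Sub n → Set
QuotIso {n} A B C D = Σ (Arr n → Arr n) λ f →
    (∀ a → a ∈ A → f a ∈ C)
  × (∀ a a' → a ∈ A → a' ∈ A → ∃ λ d → d ∈ D × f (a ∘ₚ a') ≡ ((f a ∘ₚ f a') ∘ₚ d))
  × (∀ a → a ∈ A → (f a ∈ D → a ∈ B) × (a ∈ B → f a ∈ D))
  × (∀ c → c ∈ C → ∃ λ a → a ∈ A × ∃ λ d → d ∈ D × c ≡ (f a ∘ₚ d))

-- (1) Put N = L ∩ G.  Since H normalizes N, NH is a subgroup with H ≤ NH ≤ G, so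
-- |NH : H| divides the odd index |G : H|, and the product formula |N| |H| = |NH| |N ∩ H| turns
-- this into |N : N ∩ H| = |NH : H|.  Restriction to a block Δᵢ is a homomorphism on L with
-- kernel K, and |N^Δᵢ : (L ∩ H)^Δᵢ| = |N : K (L ∩ H)| divides |N : L ∩ H|.
-- (2) Let X ≤ L and let B be a maximal normal subgroup of X.  Let Kₗ consist of the elements
-- of X acting trivially on the first l blocks.  Then K₀ B = X and K_t B = B ≠ X, so for some l
-- we have Kₗ B = X while Kₗ₊₁ B ≠ X, whence Kₗ₊₁ B = B by maximality.  Hence X/B ≅ Kₗ/(Kₗ ∩ B),
-- and restricting to the block Δₗ identifies this with Kₗ^Δₗ/(Kₗ ∩ B)^Δₗ; as Kₗ^Δₗ is normal in
-- X^Δₗ, this simple quotient is a composition factor of X^Δₗ.  Deeper factors of a composition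
-- series are handled by induction, because restriction maps normal subgroups to normal subgroups.

module Submission where

open import Defs
open import Data.Bool using (Bool; true; false; T; _∧_; _∨_; not; _xor_; if_then_else_)
open import Data.Bool.ListAction using (all; any)
open import Data.Bool.Properties using (T-∧; T-∨)
open import Data.Empty using (⊥-elim)
open import Data.Fin as Fin using (Fin; toℕ; fromℕ<)
open import Data.Fin.Properties using (_≟_; _<?_; <-cmp; <-asym; <-irrefl; toℕ-fromℕ<; toℕ-injective; toℕ<n)
open import Data.List using (List; []; _∷_; length; map; filter; filterᵇ; allFin; concatMap; _++_)
open import Data.List.Membership.Propositional using (find) renaming (_∈_ to _∈ˡ_)
open import Data.List.Membership.Propositional.Properties
  using (∈-filter⁺; ∈-filter⁻; ∈-map⁺; ∈-map⁻; ∈-allFin; ∈-concatMap⁺; ∈-concatMap⁻; ∈-cartesianProduct⁺; ∈-++⁺ˡ; ∈-++⁺ʳ)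
open import Data.List.Properties using (filter-notAll; length-map)
open import Data.List.Relation.Unary.All as All using (All; []; _∷_; all?)
open import Data.List.Relation.Unary.All.Properties as All using (all⁺; all⁻; All¬⇒¬Any)
open import Data.List.Relation.Unary.AllPairs using ([]; _∷_)
open import Data.List.Relation.Unary.Any as Any using (Any; here; there; any?)
open import Data.List.Relation.Unary.Any.Properties using (any⁺; any⁻)
open import Data.List.Relation.Unary.Unique.Propositional using (Unique)
import Data.List.Relation.Unary.Unique.Propositional.Properties as Unique
open import Data.Nat as ℕ using (ℕ; zero; suc; _+_; _*_; _≤_; _<_; z≤n; s≤s; >-nonZero)
import Data.Nat.Properties
open import Data.Nat.Properties
  using (≤-trans; ≤-antisym; ≤-reflexive; ≤-pred; <-≤-trans; n≤0⇒n≡0; n<1+n; m≤n⇒m≤1+n; m<n+m; m≤n+m; ≮⇒≥; <⇒≱;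
         +-suc; +-identityʳ; +-monoʳ-<; +-monoˡ-≤; +-comm; *-suc; *-comm; *-assoc; *-distribʳ-+; *-cancelʳ-≡; 0≢1+n)
open import Algebra.Properties.CommutativeSemigroup Data.Nat.Properties.*-commutativeSemigroup using (xy∙z≈xz∙y)
open import Data.Nat.DivMod using (_%_; _/_; m≡m%n+[m/n]*n; m*n%n≡0; [m+kn]%n≡m%n)
open import Data.Product using (∃; _×_; _,_; proj₁; proj₂; swap)
open import Data.Product.Properties using (,-injectiveˡ; ,-injectiveʳ)
open import Data.Sum using (_⊎_; inj₁; inj₂; [_,_])
open import Data.Vec using (Vec; []; _∷_; lookup; tabulate)
open import Data.Vec.Properties using (≡-dec; lookup∘tabulate; tabulate∘lookup; tabulate-cong; ∷-injectiveˡ; ∷-injectiveʳ)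
open import Function using (_∘_; _∘′_; case_of_; Equivalence)
open import Function.Definitions using (Injective)
open import Relation.Binary using (tri<; tri≈; tri>)
open import Relation.Binary.PropositionalEquality
  using (_≡_; _≢_; refl; sym; trans; cong; cong₂; subst; subst₂; module ≡-Reasoning)
open import Relation.Nullary using (¬_; Dec; yes; no; contradiction)
open import Relation.Nullary.Decidable using (⌊_⌋; T?; toWitness; fromWitness; ¬?; _×-dec_; _→-dec_)


-- Finite counting

∧-intro : ∀ {a b} → T a → T b → T (a ∧ b)
∧-intro p q = Equivalence.from T-∧ (p , q)

∧-elimˡ : ∀ {a b} → T (a ∧ b) → T a
∧-elimˡ = proj₁ ∘ Equivalence.to T-∧

∧-elimʳ : ∀ {a b} → T (a ∧ b) → T b
∧-elimʳ {a} = proj₂ ∘ Equivalence.to (T-∧ {a})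

∨-elim : ∀ {a b} → T (a ∨ b) → T a ⊎ T b
∨-elim = Equivalence.to T-∨

not-intro : ∀ {a} → ¬ T a → T (not a)
not-intro {false} _ = _
not-intro {true} ¬a = ¬a _

not-elim : ∀ {a} → T (not a) → ¬ T a
not-elim {false} _ ()

T⇔T⇒≡ : ∀ {a b} → (T a → T b) → (T b → T a) → a ≡ b
T⇔T⇒≡ {false} {false} _ _ = refl
T⇔T⇒≡ {false} {true}  _ b⇒a = ⊥-elim (b⇒a _)
T⇔T⇒≡ {true}  {false} a⇒b _ = ⊥-elim (a⇒b _)
T⇔T⇒≡ {true}  {true}  _ _ = refl

module _ {A : Set} where

  any-intro : ∀ (p : A → Bool) {xs x} → x ∈ˡ xs → T (p x) → T (any p xs)
  any-intro p x∈xs px = any⁺ p (Any.map (λ { refl → px }) x∈xs)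

  any-elim : ∀ (p : A → Bool) xs → T (any p xs) → ∃ λ x → x ∈ˡ xs × T (p x)
  any-elim p xs h = find (any⁻ p xs h)

  all-elim : ∀ (p : A → Bool) {xs x} → T (all p xs) → x ∈ˡ xs → T (p x)
  all-elim p {xs} h x∈xs = All.lookup (all⁺ p xs h) x∈xs

  all-intro : ∀ (p : A → Bool) xs → (∀ x → x ∈ˡ xs → T (p x)) → T (all p xs)
  all-intro p xs f = all⁻ p (All.tabulate (f _))

  unique-⊆⇒length-≤ : (_≟_ : (a b : A) → Dec (a ≡ b)) → ∀ {xs ys : List A} →
                      Unique xs → (∀ {x} → x ∈ˡ xs → x ∈ˡ ys) → length xs ≤ length ys
  unique-⊆⇒length-≤ _≟_ {[]} _ _ = z≤n
  unique-⊆⇒length-≤ _≟_ {x ∷ xs} {ys} (x∉xs ∷ u) xs⊆ys =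
    ≤-trans (s≤s (unique-⊆⇒length-≤ _≟_ u xs⊆ys∖x))
            (filter-notAll (λ y → ¬? (y ≟ x)) ys (Any.map (λ { refl ¬x≡x → ¬x≡x refl }) (xs⊆ys (here refl))))
    where
    xs⊆ys∖x : ∀ {y} → y ∈ˡ xs → y ∈ˡ filter (λ y → ¬? (y ≟ x)) ys
    xs⊆ys∖x {y} y∈xs = ∈-filter⁺ (λ y → ¬? (y ≟ x)) (xs⊆ys (there y∈xs))
      (λ { refl → All.lookup x∉xs y∈xs refl })

module Counting {A : Set} (_≟_ : (a b : A) → Dec (a ≡ b))
                (U : List A) (U-unique : Unique U) (U-complete : ∀ x → x ∈ˡ U) where

  Pred : Set
  Pred = A → Bool

  count : Pred → ℕ
  count S = length (filterᵇ S U)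

  _⊆ₚ_ : Pred → Pred → Set
  S ⊆ₚ R = ∀ v → T (S v) → T (R v)

  _∩ₚ_ _∖ₚ_ : Pred → Pred → Pred
  (S ∩ₚ R) v = S v ∧ R v
  (S ∖ₚ R) v = S v ∧ not (R v)

  private
    ∈-filterU⁺ : ∀ S {v} → T (S v) → v ∈ˡ filterᵇ S U
    ∈-filterU⁺ S {v} = ∈-filter⁺ (T? ∘ S) (U-complete v)

    ∈-filterU⁻ : ∀ S {v} → v ∈ˡ filterᵇ S U → T (S v)
    ∈-filterU⁻ S = proj₂ ∘ ∈-filter⁻ (T? ∘ S) {xs = U}

    filterU-unique : ∀ S → Unique (filterᵇ S U)
    filterU-unique S = Unique.filter⁺ (T? ∘ S) U-unique

    map-unique : ∀ (f : A → A) {S} → (∀ a b → T (S a) → T (S b) → f a ≡ f b → a ≡ b)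
               → ∀ {xs} → All (T ∘ S) xs → Unique xs → Unique (map f xs)
    map-unique f inj [] [] = []
    map-unique f inj (sx ∷ sxs) (x∉xs ∷ u) =
      All.map⁺ (All.zipWith (λ (sy , x≢y) fx≡fy → x≢y (inj _ _ sx sy fx≡fy)) (sxs , x∉xs)) ∷ map-unique f inj sxs u

  count-mono : ∀ {S R} → S ⊆ₚ R → count S ≤ count R
  count-mono {S} {R} S⊆R = unique-⊆⇒length-≤ _≟_ (filterU-unique S) (∈-filterU⁺ R ∘ S⊆R _ ∘ ∈-filterU⁻ S)

  count-≐ : ∀ {S R} → S ⊆ₚ R → R ⊆ₚ S → count S ≡ count R
  count-≐ S⊆R R⊆S = ≤-antisym (count-mono S⊆R) (count-mono R⊆S)

  count-split : ∀ S R → count S ≡ count (S ∩ₚ R) + count (S ∖ₚ R)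
  count-split S R = go U
    where
    go : ∀ xs → length (filterᵇ S xs) ≡ length (filterᵇ (S ∩ₚ R) xs) + length (filterᵇ (S ∖ₚ R) xs)
    go [] = refl
    go (x ∷ xs) with S x | R x
    ... | true  | true  = cong suc (go xs)
    ... | true  | false = trans (cong suc (go xs)) (sym (+-suc _ _))
    ... | false | _     = go xs

  -- Each point of S ∩ R is counted twice on the right.
  count-xor : ∀ S R → count (λ v → S v xor R v) + 2 * count (S ∩ₚ R) ≡ count S + count R
  count-xor S R = go U
    where
    c : Pred → List A → ℕ
    c P xs = length (filterᵇ P xs)
    X = λ v → S v xor R v
    go : ∀ xs → c X xs + 2 * c (S ∩ₚ R) xs ≡ c S xs + c R xs
    go [] = refl
    go (x ∷ xs) with S x | R x
    ... | true  | true  = begin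
      c X xs + 2 * suc (c (S ∩ₚ R) xs)       ≡⟨ cong (c X xs +_) (*-suc 2 (c (S ∩ₚ R) xs)) ⟩
      c X xs + suc (suc (2 * c (S ∩ₚ R) xs))  ≡⟨ +-suc (c X xs) _ ⟩
      suc (c X xs + suc (2 * c (S ∩ₚ R) xs))  ≡⟨ cong suc (+-suc (c X xs) _) ⟩
      suc (suc (c X xs + 2 * c (S ∩ₚ R) xs))  ≡⟨ cong (suc ∘ suc) (go xs) ⟩
      suc (suc (c S xs + c R xs))             ≡⟨ cong suc (+-suc (c S xs) (c R xs)) ⟨
      suc (c S xs + suc (c R xs))             ∎
      where open ≡-Reasoning
    ... | true  | false = cong suc (go xs)
    ... | false | true  = trans (cong suc (go xs)) (sym (+-suc _ _))
    ... | false | false = go xs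

  count-pos : ∀ {S} v → T (S v) → 0 < count S
  count-pos {S} v v∈S with filterᵇ S U | ∈-filterU⁺ S v∈S
  ... | _ ∷ _ | _ = s≤s z≤n

  count-empty : ∀ {S} → (∀ v → ¬ T (S v)) → count S ≡ 0
  count-empty {S} S-empty = n≤0⇒n≡0 (unique-⊆⇒length-≤ _≟_ {ys = []} (filterU-unique S)
    (λ v∈ → ⊥-elim (S-empty _ (∈-filterU⁻ S v∈))))

  count-< : ∀ {S R} → S ⊆ₚ R → ∀ v → T (R v) → ¬ T (S v) → count S < count R
  count-< {S} {R} S⊆R v v∈R v∉S = subst (count S <_) (sym (count-split R S)) (begin-strict
      count S                             ≡⟨ +-identityʳ (count S) ⟨
      count S + 0                         <⟨ +-monoʳ-< (count S) (count-pos {R ∖ₚ S} v (∧-intro v∈R (not-intro v∉S))) ⟩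
      count S + count (R ∖ₚ S)            ≡⟨ cong (_+ count (R ∖ₚ S)) (count-≐ (λ w w∈S → ∧-intro (S⊆R w w∈S) w∈S) (λ w → ∧-elimʳ {R w})) ⟩
      count (R ∩ₚ S) + count (R ∖ₚ S)     ∎)
    where open Data.Nat.Properties.≤-Reasoning

  ⊆-by-count : ∀ {S R} → S ⊆ₚ R → count R ≤ count S → R ⊆ₚ S
  ⊆-by-count {S} {R} S⊆R R≤S v v∈R with T? (S v)
  ... | yes v∈S = v∈S
  ... | no v∉S = contradiction R≤S (<⇒≱ (count-< S⊆R v v∈R v∉S))

  count-bijection : ∀ (f : A → A) {S I : Pred} → (∀ a b → T (S a) → T (S b) → f a ≡ f b → a ≡ b)
                  → (∀ s → T (S s) → T (I (f s))) → (∀ v → T (I v) → ∃ λ s → T (S s) × f s ≡ v)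
                  → count I ≡ count S
  count-bijection f {S} {I} inj into onto = ≤-antisym
    (subst (count I ≤_) (length-map f (filterᵇ S U))
      (unique-⊆⇒length-≤ _≟_ (filterU-unique I) λ v∈I →
        let (s , s∈S , fs≡v) = onto _ (∈-filterU⁻ I v∈I)
        in subst (_∈ˡ map f (filterᵇ S U)) fs≡v (∈-map⁺ f (∈-filterU⁺ S s∈S))))
    (subst (_≤ count I) (length-map f (filterᵇ S U))
      (unique-⊆⇒length-≤ _≟_ (map-unique f inj (All.all-filter (T? ∘ S) U) (filterU-unique S)) λ v∈fS →
        let (s , s∈ , v≡fs) = ∈-map⁻ f v∈fS
        in subst (_∈ˡ filterᵇ I U) (sym v≡fs) (∈-filterU⁺ I (into s (∈-filterU⁻ S s∈)))))

  count-singleton : ∀ a → count (λ v → ⌊ a ≟ v ⌋) ≡ 1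
  count-singleton a = ≤-antisym
    (unique-⊆⇒length-≤ _≟_ {ys = a ∷ []} (filterU-unique _) λ v∈ → here (sym (toWitness (∈-filterU⁻ (λ v → ⌊ a ≟ v ⌋) v∈))))
    (count-pos a (fromWitness refl))

-- Maps Ω → Ω and permutations

∈-allVecs : ∀ {n} k (v : Vec (Fin n) k) → v ∈ˡ allVecs k
∈-allVecs zero [] = Any.here refl
∈-allVecs (suc k) (x ∷ v) =
  ∈-concatMap⁺ _ (Any.map (λ { refl → ∈-map⁺ (x ∷_) (∈-allVecs k v) }) (∈-allFin x))

allVecs-unique : ∀ {n} k → Unique (allVecs {n} k)
allVecs-unique zero = [] ∷ []
allVecs-unique {n} (suc k) = go (allFin n) (Unique.allFin⁺ n)
  where
  extend : List (Fin n) → List (Vec (Fin n) (suc k))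
  extend = concatMap (λ x → map (x ∷_) (allVecs k))
  go : ∀ xs → Unique xs → Unique (extend xs)
  go [] _ = []
  go (x ∷ xs) (x∉xs ∷ xs!) = Unique.++⁺ (Unique.map⁺ ∷-injectiveʳ (allVecs-unique k)) (go xs xs!) disjoint
    where
    disjoint : ∀ {v} → ¬ (v ∈ˡ map (x ∷_) (allVecs k) × v ∈ˡ extend xs)
    disjoint (v∈x∷ , v∈rest) with ∈-map⁻ (x ∷_) v∈x∷
    ... | (w , _ , refl) = All¬⇒¬Any x∉xs
      (Any.map (λ m → ∷-injectiveˡ (proj₂ (proj₂ (∈-map⁻ _ m)))) (∈-concatMap⁻ _ {xs = xs} v∈rest))

pairs-unique : ∀ n → Unique (pairs n)
pairs-unique n = Unique.cartesianProduct⁺ (Unique.allFin⁺ n) (Unique.allFin⁺ n)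

∈-pairs : ∀ {n} (p : Fin n × Fin n) → p ∈ˡ pairs n
∈-pairs (i , j) = ∈-cartesianProduct⁺ (∈-allFin i) (∈-allFin j)

_≟ₚ_ : ∀ {n} (v w : Arr n) → Dec (v ≡ w)
_≟ₚ_ = ≡-dec _≟_

module CountArr (n : ℕ) = Counting _≟ₚ_ (allArr n) (allVecs-unique n) (∈-allVecs n)
module CountPairs (n : ℕ) = Counting (Data.Product.Properties.≡-dec _≟_ _≟_) (pairs n) (pairs-unique n) ∈-pairs

module _ {n : ℕ} where
  open ≡-Reasoning

  lookup-∘ₚ : ∀ (v w : Arr n) i → lookup (v ∘ₚ w) i ≡ lookup v (lookup w i)
  lookup-∘ₚ v w = lookup∘tabulate _

  lookup-idₚ : ∀ i → lookup (idₚ {n}) i ≡ i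
  lookup-idₚ = lookup∘tabulate _

  ≟A-sound : ∀ {v w : Arr n} → T (v ≟A w) → v ≡ w
  ≟A-sound = toWitness

  ≟A-complete : ∀ {v w : Arr n} → v ≡ w → T (v ≟A w)
  ≟A-complete = fromWitness

  Arr-ext : ∀ {v w : Arr n} → (∀ i → lookup v i ≡ lookup w i) → v ≡ w
  Arr-ext {v} {w} v≗w = begin
    v                   ≡⟨ tabulate∘lookup v ⟨
    tabulate (lookup v) ≡⟨ tabulate-cong v≗w ⟩
    tabulate (lookup w) ≡⟨ tabulate∘lookup w ⟩
    w                   ∎

  ∘ₚ-assoc : ∀ (u v w : Arr n) → (u ∘ₚ v) ∘ₚ w ≡ u ∘ₚ (v ∘ₚ w)
  ∘ₚ-assoc u v w = Arr-ext λ i → begin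
    lookup ((u ∘ₚ v) ∘ₚ w) i        ≡⟨ lookup-∘ₚ (u ∘ₚ v) w i ⟩
    lookup (u ∘ₚ v) (lookup w i)    ≡⟨ lookup-∘ₚ u v (lookup w i) ⟩
    lookup u (lookup v (lookup w i)) ≡⟨ cong (lookup u) (lookup-∘ₚ v w i) ⟨
    lookup u (lookup (v ∘ₚ w) i)    ≡⟨ lookup-∘ₚ u (v ∘ₚ w) i ⟨
    lookup (u ∘ₚ (v ∘ₚ w)) i        ∎

  ∘ₚ-identityˡ : ∀ (v : Arr n) → idₚ ∘ₚ v ≡ v
  ∘ₚ-identityˡ v = Arr-ext λ i → trans (lookup-∘ₚ idₚ v i) (lookup-idₚ _)

  ∘ₚ-identityʳ : ∀ (v : Arr n) → v ∘ₚ idₚ ≡ v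
  ∘ₚ-identityʳ v = Arr-ext λ i → trans (lookup-∘ₚ v idₚ i) (cong (lookup v) (lookup-idₚ i))

  private
    separates : Arr n → Fin n × Fin n → Bool
    separates v (i , j) = not ⌊ lookup v i ≟ lookup v j ⌋ ∨ ⌊ i ≟ j ⌋

  isPerm⇒injective : ∀ (v : Arr n) → T (isPerm v) → Injective _≡_ _≡_ (lookup v)
  isPerm⇒injective v v-perm {i} {j} vi≡vj
    with ∨-elim {not ⌊ lookup v i ≟ lookup v j ⌋} (all-elim (separates v) {pairs n} v-perm (∈-pairs (i , j)))
  ... | inj₁ vi≢vj = contradiction (fromWitness vi≡vj) (not-elim vi≢vj)
  ... | inj₂ i≡j = toWitness i≡j

  injective⇒isPerm : ∀ (v : Arr n) → Injective _≡_ _≡_ (lookup v) → T (isPerm v)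
  injective⇒isPerm v v-inj = all-intro (separates v) (pairs n) λ { (i , j) _ → pair-ok i j }
    where
    pair-ok : ∀ i j → T (separates v (i , j))
    pair-ok i j with lookup v i ≟ lookup v j
    ... | yes vi≡vj = fromWitness (v-inj vi≡vj)
    ... | no _ = _

  isPerm-∘ₚ : ∀ (v w : Arr n) → T (isPerm v) → T (isPerm w) → T (isPerm (v ∘ₚ w))
  isPerm-∘ₚ v w v-perm w-perm = injective⇒isPerm (v ∘ₚ w) λ {i} {j} e →
    isPerm⇒injective w w-perm (isPerm⇒injective v v-perm
      (trans (sym (lookup-∘ₚ v w i)) (trans e (lookup-∘ₚ v w j))))

  isPerm-idₚ : T (isPerm (idₚ {n}))
  isPerm-idₚ = injective⇒isPerm idₚ λ {i} {j} e → trans (sym (lookup-idₚ i)) (trans e (lookup-idₚ j))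

  ∘ₚ-cancelˡ : ∀ (v : Arr n) {a b : Arr n} → T (isPerm v) → v ∘ₚ a ≡ v ∘ₚ b → a ≡ b
  ∘ₚ-cancelˡ v {a} {b} v-perm e = Arr-ext λ i → isPerm⇒injective v v-perm
    (trans (sym (lookup-∘ₚ v a i)) (trans (cong (λ z → lookup z i) e) (lookup-∘ₚ v b i)))

-- Permutation groups

module _ {n : ℕ} where
  open CountArr n
  open ≡-Reasoning

  -- induced part i X is definitionally img (restrict part i) X.
  img : (Arr n → Arr n) → Sub n → Sub n
  img f S u = any (λ s → S s ∧ (f s ≟A u)) (allArr n)

  img-intro : ∀ f (S : Sub n) {s} → s ∈ S → f s ∈ img f S
  img-intro f S {s} s∈S = any-intro _ (∈-allVecs n s) (∧-intro s∈S (≟A-complete refl))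

  img-elim : ∀ f (S : Sub n) {u} → u ∈ img f S → ∃ λ s → s ∈ S × f s ≡ u
  img-elim f S h with any-elim _ (allArr n) h
  ... | (s , _ , s∈S∧fs≡u) = s , ∧-elimˡ s∈S∧fs≡u , ≟A-sound (∧-elimʳ {S s} s∈S∧fs≡u)

  inverse : ∀ {S : Sub n} → IsPermGroup S → ∀ v → v ∈ S → ∃ λ w → w ∈ S × (v ∘ₚ w ≡ idₚ) × (w ∘ₚ v ≡ idₚ)
  inverse {S} (S-perm , id∈S , S-closed) v v∈S = w , w∈S , vw≡id , wv≡id
    where
    v-perm = S-perm v v∈S
    vS⊆S : img (v ∘ₚ_) S ⊆ S
    vS⊆S u h with img-elim (v ∘ₚ_) S h
    ... | (s , s∈S , refl) = S-closed v s v∈S s∈S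
    -- Left multiplication by v is injective, so by finiteness it maps S onto S.
    S⊆vS : S ⊆ img (v ∘ₚ_) S
    S⊆vS = ⊆-by-count vS⊆S (≤-reflexive (sym (count-bijection (v ∘ₚ_) {S} {img (v ∘ₚ_) S}
      (λ _ _ _ _ → ∘ₚ-cancelˡ v v-perm) (λ _ → img-intro _ S) (λ _ → img-elim _ S))))
    w = proj₁ (img-elim (v ∘ₚ_) S (S⊆vS idₚ id∈S))
    w∈S = proj₁ (proj₂ (img-elim (v ∘ₚ_) S (S⊆vS idₚ id∈S)))
    vw≡id = proj₂ (proj₂ (img-elim (v ∘ₚ_) S (S⊆vS idₚ id∈S)))
    wv≡id : w ∘ₚ v ≡ idₚ
    wv≡id = ∘ₚ-cancelˡ v v-perm (begin
      v ∘ₚ (w ∘ₚ v) ≡⟨ ∘ₚ-assoc v w v ⟨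
      (v ∘ₚ w) ∘ₚ v ≡⟨ cong (_∘ₚ v) vw≡id ⟩
      idₚ ∘ₚ v      ≡⟨ ∘ₚ-identityˡ v ⟩
      v             ≡⟨ ∘ₚ-identityʳ v ⟨
      v ∘ₚ idₚ      ∎)

  Sym-isPermGroup : IsPermGroup (Symₙ n)
  Sym-isPermGroup = (λ v v-perm → v-perm) , isPerm-idₚ {n} , isPerm-∘ₚ

  ∘ₚ-cancelˡ-inverse : ∀ (x x' y : Arr n) → x ∘ₚ x' ≡ idₚ → x ∘ₚ (x' ∘ₚ y) ≡ y
  ∘ₚ-cancelˡ-inverse x x' y xx'≡id = trans (sym (∘ₚ-assoc x x' y)) (trans (cong (_∘ₚ y) xx'≡id) (∘ₚ-identityˡ y))

  ∘ₚ-cancelʳ-inverse : ∀ (x y y' : Arr n) → y ∘ₚ y' ≡ idₚ → (x ∘ₚ y) ∘ₚ y' ≡ x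
  ∘ₚ-cancelʳ-inverse x y y' yy'≡id = trans (∘ₚ-assoc x y y') (trans (cong (x ∘ₚ_) yy'≡id) (∘ₚ-identityʳ x))

  ∘ₚ-cancelʳ : ∀ (v : Arr n) {a b : Arr n} → T (isPerm v) → a ∘ₚ v ≡ b ∘ₚ v → a ≡ b
  ∘ₚ-cancelʳ v {a} {b} v-perm av≡bv with inverse Sym-isPermGroup v v-perm
  ... | (w , _ , vw≡id , _) = begin
    a             ≡⟨ ∘ₚ-cancelʳ-inverse a v w vw≡id ⟨
    (a ∘ₚ v) ∘ₚ w ≡⟨ cong (_∘ₚ w) av≡bv ⟩
    (b ∘ₚ v) ∘ₚ w ≡⟨ ∘ₚ-cancelʳ-inverse b v w vw≡id ⟩
    b             ∎

  module PermGroup {S : Sub n} (S-group : IsPermGroup S) where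
    perm : ∀ v → v ∈ S → T (isPerm v)
    perm = proj₁ S-group

    id∈ : idₚ ∈ S
    id∈ = proj₁ (proj₂ S-group)

    ∘∈ : ∀ v w → v ∈ S → w ∈ S → (v ∘ₚ w) ∈ S
    ∘∈ = proj₂ (proj₂ S-group)

    inv : ∀ v → v ∈ S → Arr n
    inv v v∈S = proj₁ (inverse S-group v v∈S)

    inv∈ : ∀ v (v∈S : v ∈ S) → inv v v∈S ∈ S
    inv∈ v v∈S = proj₁ (proj₂ (inverse S-group v v∈S))

    inverseʳ : ∀ v (v∈S : v ∈ S) → v ∘ₚ inv v v∈S ≡ idₚ
    inverseʳ v v∈S = proj₁ (proj₂ (proj₂ (inverse S-group v v∈S)))

    inverseˡ : ∀ v (v∈S : v ∈ S) → inv v v∈S ∘ₚ v ≡ idₚ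
    inverseˡ v v∈S = proj₂ (proj₂ (proj₂ (inverse S-group v v∈S)))

    right-factor∈ : ∀ s x t → s ∈ S → x ∈ S → x ≡ s ∘ₚ t → t ∈ S
    right-factor∈ s x t s∈S x∈S x≡st =
      subst (_∈ S) (trans (cong (inv s s∈S ∘ₚ_) x≡st) (∘ₚ-cancelˡ-inverse (inv s s∈S) s t (inverseˡ s s∈S)))
            (∘∈ _ x (inv∈ s s∈S) x∈S)

  ∩-isPermGroup : ∀ {S R : Sub n} → IsPermGroup S → IsPermGroup R → IsPermGroup (S ∩ R)
  ∩-isPermGroup {S} {R} S-grp R-grp =
    (λ v v∈ → S.perm v (∧-elimˡ v∈)) , ∧-intro {S idₚ} S.id∈ R.id∈ ,
    λ v w v∈ w∈ → ∧-intro {S (v ∘ₚ w)} (S.∘∈ v w (∧-elimˡ v∈) (∧-elimˡ w∈)) (R.∘∈ v w (∧-elimʳ {S v} v∈) (∧-elimʳ {S w} w∈))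
    where module S = PermGroup S-grp
          module R = PermGroup R-grp

-- Cosets, Lagrange's theorem and the product formula

module _ {n : ℕ} where
  open CountArr n
  open ≡-Reasoning

  chooseFrom : (Arr n → Bool) → List (Arr n) → Arr n
  chooseFrom p [] = idₚ
  chooseFrom p (x ∷ xs) = if p x then x else chooseFrom p xs

  chooseFrom-sound : ∀ (p : Arr n → Bool) {xs v} → v ∈ˡ xs → T (p v) → T (p (chooseFrom p xs))
  chooseFrom-sound p {x ∷ xs} v∈ pv with p x in px
  ... | true = subst T (sym px) _
  chooseFrom-sound p {x ∷ xs} (here refl) pv | false = ⊥-elim (subst T px pv)
  chooseFrom-sound p {x ∷ xs} (there v∈) pv | false = chooseFrom-sound p v∈ pv

  chooseFrom-cong : ∀ {p q} → (∀ v → p v ≡ q v) → ∀ xs → chooseFrom p xs ≡ chooseFrom q xs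
  chooseFrom-cong p≗q [] = refl
  chooseFrom-cong {p} {q} p≗q (x ∷ xs) rewrite p≗q x with q x
  ... | true = refl
  ... | false = chooseFrom-cong p≗q xs

  choose : (Arr n → Bool) → Arr n
  choose p = chooseFrom p (allArr n)

  choose-sound : ∀ (p : Arr n → Bool) v → T (p v) → T (p (choose p))
  choose-sound p v = chooseFrom-sound p (∈-allVecs n v)

  RightClosed : Sub n → Sub n → Set
  RightClosed S K = ∀ s k → s ∈ S → k ∈ K → (s ∘ₚ k) ∈ S

  coset : Arr n → Sub n → Sub n
  coset s K = img (s ∘ₚ_) K

  SeparatesCosets : (Arr n → Arr n) → Sub n → Sub n → Set
  SeparatesCosets f S K = ∀ x y → x ∈ S → y ∈ S → (f x ≡ f y → y ∈ coset x K) × (y ∈ coset x K → f x ≡ f y)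

  card-coset : ∀ {s} → T (isPerm s) → (K : Sub n) → card (coset s K) ≡ card K
  card-coset {s} s-perm K = count-bijection (s ∘ₚ_) (λ _ _ _ _ → ∘ₚ-cancelˡ s s-perm) (λ _ → img-intro _ K) (λ _ → img-elim _ K)

  coset-⊆ : ∀ {S K} → RightClosed S K → ∀ {s} → s ∈ S → coset s K ⊆ S
  coset-⊆ {S} {K} S-closed {s} s∈S u u∈sK with img-elim (s ∘ₚ_) K u∈sK
  ... | (k , k∈K , refl) = S-closed s k s∈S k∈K

  subgroup-rightClosed : ∀ {S K} → IsPermGroup S → K ⊆ S → RightClosed S K
  subgroup-rightClosed S-grp K⊆S s k s∈S k∈K = PermGroup.∘∈ S-grp s k s∈S (K⊆S k k∈K)

  ∈-coset-self : ∀ {K} → idₚ ∈ K → ∀ s → s ∈ coset s K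
  ∈-coset-self {K} id∈K s = subst (_∈ coset s K) (∘ₚ-identityʳ s) (img-intro (s ∘ₚ_) K id∈K)

  module PeelCoset {K : Sub n} (f : Arr n → Arr n) {S : Sub n} (S-closed : RightClosed S K)
                   (sep : SeparatesCosets f S K) {s : Arr n} (s-perm : T (isPerm s)) (s∈S : s ∈ S) where
    rest : Sub n
    rest = S ∖ₚ coset s K

    card-peel : card S ≡ card K + card rest
    card-peel = trans (count-split S (coset s K))
      (cong (_+ card rest) (trans (count-≐ (λ v → ∧-elimʳ {S v}) (λ v v∈sK → ∧-intro (coset-⊆ S-closed s∈S v v∈sK) v∈sK))
                                  (card-coset {s} s-perm K)))

    private
      fs≡fx⇒x∈sK : ∀ {x} → x ∈ S → f s ≡ f x → x ∈ coset s K
      fs≡fx⇒x∈sK {x} x∈S = proj₁ (sep s x s∈S x∈S)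

    rest-rightClosed : RightClosed rest K
    rest-rightClosed x k x∈rest k∈K = ∧-intro xk∈S (not-intro λ xk∈sK → not-elim (∧-elimʳ {S x} x∈rest)
      (fs≡fx⇒x∈sK x∈S (trans (proj₂ (sep s (x ∘ₚ k) s∈S xk∈S) xk∈sK)
                              (sym (proj₂ (sep x (x ∘ₚ k) x∈S xk∈S) (img-intro (x ∘ₚ_) K k∈K))))))
      where
      x∈S = ∧-elimˡ x∈rest
      xk∈S = S-closed x k x∈S k∈K

    card-img-peel : card (img f S) ≡ suc (card (img f rest))
    card-img-peel = trans (count-split (img f S) (f s ≟A_)) (cong₂ _+_
      (trans (count-≐ (λ v → ∧-elimʳ {img f S v})
                      (λ v fs≡v → ∧-intro (subst (_∈ img f S) (≟A-sound fs≡v) (img-intro f S s∈S)) fs≡v))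
             (count-singleton (f s)))
      (count-≐ fS∖fs⊆f[rest] f[rest]⊆fS∖fs))
      where
      fS∖fs⊆f[rest] : (img f S ∖ₚ (f s ≟A_)) ⊆ img f rest
      fS∖fs⊆f[rest] u u∈ with (x , x∈S , refl) ← img-elim f S (∧-elimˡ u∈) =
        img-intro f rest (∧-intro x∈S (not-intro λ x∈sK →
          not-elim (∧-elimʳ {img f S (f x)} u∈) (≟A-complete (proj₂ (sep s x s∈S x∈S) x∈sK))))
      f[rest]⊆fS∖fs : img f rest ⊆ (img f S ∖ₚ (f s ≟A_))
      f[rest]⊆fS∖fs u u∈ with (x , x∈rest , refl) ← img-elim f rest u∈ =
        ∧-intro (img-intro f S (∧-elimˡ x∈rest)) (not-intro λ fs≡fx →
          not-elim (∧-elimʳ {S x} x∈rest) (fs≡fx⇒x∈sK (∧-elimˡ x∈rest) (≟A-sound fs≡fx)))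

  -- Peel off the coset s K of some s ∈ S: it has card K elements of S and contributes the single value f s.
  fibre-count : ∀ {K} → IsPermGroup K → ∀ (f : Arr n → Arr n) {S} → (∀ v → v ∈ S → T (isPerm v))
              → RightClosed S K → SeparatesCosets f S K → card S ≡ card (img f S) * card K
  fibre-count {K} K-grp f {S} = go (suc (card S)) (n<1+n _)
    where
    go : ∀ fuel {S} → card S < fuel → (∀ v → v ∈ S → T (isPerm v)) → RightClosed S K → SeparatesCosets f S K
       → card S ≡ card (img f S) * card K
    go zero () _ _ _
    go (suc fuel) {S} S<fuel S-perm S-closed sep with T? (any S (allArr n))
    ... | no S-empty = begin
      card S                   ≡⟨ count-empty (λ v v∈S → S-empty (any-intro S (∈-allVecs n v) v∈S)) ⟩
      0                        ≡⟨ cong (_* card K) (count-empty fS-empty) ⟨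
      card (img f S) * card K  ∎
      where
      fS-empty : ∀ u → ¬ u ∈ img f S
      fS-empty u u∈fS with (v , v∈S , _) ← img-elim f S u∈fS = S-empty (any-intro S (∈-allVecs n v) v∈S)
    ... | yes S-inhabited with (s , _ , s∈S) ← any-elim S (allArr n) S-inhabited = begin
      card S                                ≡⟨ card-peel ⟩
      card K + card rest                    ≡⟨ cong (card K +_) (go fuel rest<fuel rest-perm rest-rightClosed rest-sep) ⟩
      card K + card (img f rest) * card K   ≡⟨ cong (_* card K) card-img-peel ⟨
      card (img f S) * card K               ∎
      where
      open PeelCoset f S-closed sep (S-perm s s∈S) s∈S
      rest<fuel : card rest < fuel
      rest<fuel = <-≤-trans (m<n+m (card rest) (count-pos idₚ (PermGroup.id∈ K-grp)))
                            (≤-pred (subst (_< suc fuel) card-peel S<fuel))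
      rest-perm : ∀ v → v ∈ rest → T (isPerm v)
      rest-perm v v∈rest = S-perm v (∧-elimˡ v∈rest)
      rest-sep : SeparatesCosets f rest K
      rest-sep x y x∈rest y∈rest = sep x y (∧-elimˡ x∈rest) (∧-elimˡ y∈rest)

  cosetRep : Sub n → Arr n → Arr n
  cosetRep K x = choose (coset x K)

  module _ {K : Sub n} (K-grp : IsPermGroup K) where
    private module K = PermGroup K-grp

    coset-≗ : ∀ x y → y ∈ coset x K → ∀ v → coset x K v ≡ coset y K v
    coset-≗ x y y∈xK v with (k , k∈K , refl) ← img-elim (x ∘ₚ_) K y∈xK = T⇔T⇒≡ xK⊆yK yK⊆xK
      where
      xK⊆yK : v ∈ coset x K → v ∈ coset (x ∘ₚ k) K
      xK⊆yK v∈xK with (k' , k'∈K , refl) ← img-elim (x ∘ₚ_) K v∈xK =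
        subst (_∈ coset (x ∘ₚ k) K)
          (trans (∘ₚ-assoc x k (k⁻¹ ∘ₚ k')) (cong (x ∘ₚ_) (∘ₚ-cancelˡ-inverse k k⁻¹ k' (K.inverseʳ k k∈K))))
          (img-intro ((x ∘ₚ k) ∘ₚ_) K (K.∘∈ k⁻¹ k' (K.inv∈ k k∈K) k'∈K))
        where k⁻¹ = K.inv k k∈K
      yK⊆xK : v ∈ coset (x ∘ₚ k) K → v ∈ coset x K
      yK⊆xK v∈yK with (k' , k'∈K , refl) ← img-elim ((x ∘ₚ k) ∘ₚ_) K v∈yK =
        subst (_∈ coset x K) (sym (∘ₚ-assoc x k k')) (img-intro (x ∘ₚ_) K (K.∘∈ k k' k∈K k'∈K))

    cosetRep-∈ : ∀ x → cosetRep K x ∈ coset x K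
    cosetRep-∈ x = choose-sound (coset x K) x (∈-coset-self K.id∈ x)

    cosetRep-separates : ∀ S → SeparatesCosets (cosetRep K) S K
    cosetRep-separates S x y _ _ = same-rep⇒∈coset , λ y∈xK → chooseFrom-cong (coset-≗ x y y∈xK) (allArr n)
      where
      same-rep⇒∈coset : cosetRep K x ≡ cosetRep K y → y ∈ coset x K
      same-rep⇒∈coset rx≡ry
        with (k₁ , k₁∈K , x≡) ← img-elim (x ∘ₚ_) K (cosetRep-∈ x)
           | (k₂ , k₂∈K , y≡) ← img-elim (y ∘ₚ_) K (cosetRep-∈ y) =
        subst (_∈ coset x K) y≡x∘k₁k₂⁻¹ (img-intro (x ∘ₚ_) K (K.∘∈ k₁ (K.inv k₂ k₂∈K) k₁∈K (K.inv∈ k₂ k₂∈K)))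
        where
        y≡x∘k₁k₂⁻¹ : x ∘ₚ (k₁ ∘ₚ K.inv k₂ k₂∈K) ≡ y
        y≡x∘k₁k₂⁻¹ = begin
          x ∘ₚ (k₁ ∘ₚ K.inv k₂ k₂∈K)   ≡⟨ ∘ₚ-assoc x k₁ (K.inv k₂ k₂∈K) ⟨
          (x ∘ₚ k₁) ∘ₚ K.inv k₂ k₂∈K   ≡⟨ cong (_∘ₚ K.inv k₂ k₂∈K) (trans x≡ (trans rx≡ry (sym y≡))) ⟩
          (y ∘ₚ k₂) ∘ₚ K.inv k₂ k₂∈K   ≡⟨ ∘ₚ-cancelʳ-inverse y k₂ (K.inv k₂ k₂∈K) (K.inverseʳ k₂ k₂∈K) ⟩
          y                            ∎

    lagrange : ∀ {S} → (∀ v → v ∈ S → T (isPerm v)) → RightClosed S K → ∃ λ m → card S ≡ m * card K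
    lagrange {S} S-perm S-closed = card (img (cosetRep K) S) , fibre-count K-grp (cosetRep K) S-perm S-closed (cosetRep-separates S)

  infixl 7 _·_
  _·_ : Sub n → Sub n → Sub n
  (S · R) u = any (λ x → S x ∧ any (λ y → R y ∧ ((x ∘ₚ y) ≟A u)) (allArr n)) (allArr n)

  ·-intro : ∀ S R {x y} → x ∈ S → y ∈ R → (x ∘ₚ y) ∈ (S · R)
  ·-intro S R {x} {y} x∈S y∈R =
    any-intro _ (∈-allVecs n x) (∧-intro x∈S (any-intro _ (∈-allVecs n y) (∧-intro y∈R (≟A-complete refl))))

  ·-elim : ∀ S R {u} → u ∈ (S · R) → ∃ λ x → ∃ λ y → x ∈ S × y ∈ R × x ∘ₚ y ≡ u
  ·-elim S R {u} u∈SR with (x , _ , x∈S∧…) ← any-elim _ (allArr n) u∈SR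
                        with (y , _ , y∈R∧…) ← any-elim _ (allArr n) (∧-elimʳ {S x} x∈S∧…) =
    x , y , ∧-elimˡ x∈S∧… , ∧-elimˡ y∈R∧… , ≟A-sound (∧-elimʳ {R y} y∈R∧…)

  ⊆-·ˡ : ∀ S R → idₚ ∈ R → S ⊆ (S · R)
  ⊆-·ˡ S R id∈R v v∈S = subst (_∈ (S · R)) (∘ₚ-identityʳ v) (·-intro S R v∈S id∈R)

  ⊆-·ʳ : ∀ S R → idₚ ∈ S → R ⊆ (S · R)
  ⊆-·ʳ S R id∈S v v∈R = subst (_∈ (S · R)) (∘ₚ-identityˡ v) (·-intro S R id∈S v∈R)

  ·-⊆ : ∀ {S R A} → IsPermGroup A → S ⊆ A → R ⊆ A → (S · R) ⊆ A
  ·-⊆ {S} {R} A-grp S⊆A R⊆A u u∈SR with (x , y , x∈S , y∈R , refl) ← ·-elim S R u∈SR =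
    PermGroup.∘∈ A-grp x y (S⊆A x x∈S) (R⊆A y y∈R)

  ·-rightClosed : ∀ S {R} → IsPermGroup R → RightClosed (S · R) R
  ·-rightClosed S {R} R-grp u r u∈SR r∈R with (x , y , x∈S , y∈R , refl) ← ·-elim S R u∈SR =
    subst (_∈ (S · R)) (sym (∘ₚ-assoc x y r)) (·-intro S R x∈S (PermGroup.∘∈ R-grp y r y∈R r∈R))

  ·-isPermGroup : ∀ {N H} → IsPermGroup N → IsPermGroup H → Normalizes H N → IsPermGroup (N · H)
  ·-isPermGroup {N} {H} N-grp H-grp H-normalizes-N = NH-perm , ⊆-·ˡ N H H.id∈ idₚ N.id∈ , NH-closed
    where
    module N = PermGroup N-grp
    module H = PermGroup H-grp
    NH-perm : ∀ u → u ∈ (N · H) → T (isPerm u)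
    NH-perm u u∈NH with (x , h , x∈N , h∈H , refl) ← ·-elim N H u∈NH = isPerm-∘ₚ x h (N.perm x x∈N) (H.perm h h∈H)
    NH-closed : ∀ u u' → u ∈ (N · H) → u' ∈ (N · H) → (u ∘ₚ u') ∈ (N · H)
    NH-closed u u' u∈NH u'∈NH
      with (x , h , x∈N , h∈H , refl) ← ·-elim N H u∈NH
         | (x' , h' , x'∈N , h'∈H , refl) ← ·-elim N H u'∈NH
      with (y , y∈N , hx'≡yh) ← H-normalizes-N h x' h∈H x'∈N =
      subst (_∈ (N · H)) (sym xhx'h'≡xyhh') (·-intro N H (N.∘∈ x y x∈N y∈N) (H.∘∈ h h' h∈H h'∈H))
      where
      xhx'h'≡xyhh' : (x ∘ₚ h) ∘ₚ (x' ∘ₚ h') ≡ (x ∘ₚ y) ∘ₚ (h ∘ₚ h')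
      xhx'h'≡xyhh' = begin
        (x ∘ₚ h) ∘ₚ (x' ∘ₚ h')   ≡⟨ ∘ₚ-assoc x h (x' ∘ₚ h') ⟩
        x ∘ₚ (h ∘ₚ (x' ∘ₚ h'))   ≡⟨ cong (x ∘ₚ_) (∘ₚ-assoc h x' h') ⟨
        x ∘ₚ ((h ∘ₚ x') ∘ₚ h')   ≡⟨ cong (λ z → x ∘ₚ (z ∘ₚ h')) hx'≡yh ⟩
        x ∘ₚ ((y ∘ₚ h) ∘ₚ h')    ≡⟨ cong (x ∘ₚ_) (∘ₚ-assoc y h h') ⟩
        x ∘ₚ (y ∘ₚ (h ∘ₚ h'))    ≡⟨ ∘ₚ-assoc x y (h ∘ₚ h') ⟨
        (x ∘ₚ y) ∘ₚ (h ∘ₚ h')    ∎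

  product-formula : ∀ {N H} → IsPermGroup N → IsPermGroup H → card N * card H ≡ card (N · H) * card (N ∩ H)
  product-formula {N} {H} N-grp H-grp = begin
    card N * card H                                 ≡⟨ cong (_* card H) card-N ⟩
    card (img rep N) * card (N ∩ H) * card H        ≡⟨ xy∙z≈xz∙y (card (img rep N)) (card (N ∩ H)) (card H) ⟩
    card (img rep N) * card H * card (N ∩ H)        ≡⟨ cong (λ m → m * card H * card (N ∩ H)) repN≡repNH ⟩
    card (img rep (N · H)) * card H * card (N ∩ H)  ≡⟨ cong (_* card (N ∩ H)) card-NH ⟨
    card (N · H) * card (N ∩ H)                     ∎
    where
    module N = PermGroup N-grp
    module H = PermGroup H-grp
    rep = cosetRep H
    sep = cosetRep-separates H-grp
    -- Inside N, a left coset of H meets N in a left coset of N ∩ H.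
    sepN : SeparatesCosets rep N (N ∩ H)
    sepN x y x∈N y∈N = to , from
      where
      to : rep x ≡ rep y → y ∈ coset x (N ∩ H)
      to rx≡ry = let (h , h∈H , xh≡y) = img-elim (x ∘ₚ_) H (proj₁ (sep N x y x∈N y∈N) rx≡ry) in
        subst (_∈ coset x (N ∩ H)) xh≡y
              (img-intro (x ∘ₚ_) (N ∩ H) (∧-intro (N.right-factor∈ x y h x∈N y∈N (sym xh≡y)) h∈H))
      from : y ∈ coset x (N ∩ H) → rep x ≡ rep y
      from y∈xK = let (k , k∈K , xk≡y) = img-elim (x ∘ₚ_) (N ∩ H) y∈xK in
        proj₂ (sep N x y x∈N y∈N) (subst (_∈ coset x H) xk≡y (img-intro (x ∘ₚ_) H (∧-elimʳ {N k} k∈K)))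
    card-N : card N ≡ card (img rep N) * card (N ∩ H)
    card-N = fibre-count (∩-isPermGroup N-grp H-grp) rep N.perm (subgroup-rightClosed N-grp (λ v → ∧-elimˡ {N v})) sepN
    NH-perm : ∀ u → u ∈ (N · H) → T (isPerm u)
    NH-perm u u∈NH with (x , h , x∈N , h∈H , refl) ← ·-elim N H u∈NH = isPerm-∘ₚ x h (N.perm x x∈N) (H.perm h h∈H)
    card-NH : card (N · H) ≡ card (img rep (N · H)) * card H
    card-NH = fibre-count H-grp rep NH-perm (·-rightClosed N H-grp) (sep (N · H))
    repN⊆repNH : img rep N ⊆ img rep (N · H)
    repN⊆repNH u u∈ = let (x , x∈N , rx≡u) = img-elim rep N u∈ in
      subst (_∈ img rep (N · H)) rx≡u (img-intro rep (N · H) (⊆-·ˡ N H H.id∈ x x∈N))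
    repNH⊆repN : img rep (N · H) ⊆ img rep N
    repNH⊆repN u u∈ =
      let (v , v∈NH , rv≡u) = img-elim rep (N · H) u∈
          (x , h , x∈N , h∈H , xh≡v) = ·-elim N H v∈NH
          rx≡rv = proj₂ (sep (N · H) x v (⊆-·ˡ N H H.id∈ x x∈N) v∈NH)
                        (subst (_∈ coset x H) xh≡v (img-intro (x ∘ₚ_) H h∈H))
      in subst (_∈ img rep N) (trans rx≡rv rv≡u) (img-intro rep N x∈N)
    repN≡repNH : card (img rep N) ≡ card (img rep (N · H))
    repN≡repNH = count-≐ {img rep N} {img rep (N · H)} repN⊆repNH repNH⊆repN

  kernel : (Arr n → Arr n) → Sub n → Sub n
  kernel f A v = A v ∧ (f v ≟A idₚ)

  IsHomOn : (Arr n → Arr n) → Sub n → Set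
  IsHomOn f A = ∀ a b → a ∈ A → b ∈ A → f (a ∘ₚ b) ≡ f a ∘ₚ f b

  module Hom {A : Sub n} (A-grp : IsPermGroup A) (f : Arr n → Arr n) (f-hom : IsHomOn f A) (f-id : f idₚ ≡ idₚ) where
    private module A = PermGroup A-grp

    kernel-isPermGroup : IsPermGroup (kernel f A)
    kernel-isPermGroup =
      (λ v v∈K → A.perm v (∧-elimˡ v∈K)) , ∧-intro {A idₚ} A.id∈ (≟A-complete f-id) ,
      λ v w v∈K w∈K → ∧-intro {A (v ∘ₚ w)} (A.∘∈ v w (∧-elimˡ v∈K) (∧-elimˡ w∈K)) (≟A-complete (begin
        f (v ∘ₚ w)    ≡⟨ f-hom v w (∧-elimˡ v∈K) (∧-elimˡ w∈K) ⟩
        f v ∘ₚ f w    ≡⟨ cong₂ _∘ₚ_ (≟A-sound (∧-elimʳ {A v} v∈K)) (≟A-sound (∧-elimʳ {A w} w∈K)) ⟩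
        idₚ ∘ₚ idₚ    ≡⟨ ∘ₚ-identityˡ idₚ ⟩
        idₚ           ∎))

    kernel-separates : ∀ {S} → S ⊆ A → SeparatesCosets f S (kernel f A)
    kernel-separates {S} S⊆A x y x∈S y∈S = same-image⇒∈coset , ∈coset⇒same-image
      where
      x∈A = S⊆A x x∈S
      x⁻¹ = A.inv x x∈A
      same-image⇒∈coset : f x ≡ f y → y ∈ coset x (kernel f A)
      same-image⇒∈coset fx≡fy = subst (_∈ coset x (kernel f A)) (∘ₚ-cancelˡ-inverse x x⁻¹ y (A.inverseʳ x x∈A))
        (img-intro (x ∘ₚ_) (kernel f A) (∧-intro {A (x⁻¹ ∘ₚ y)} (A.∘∈ x⁻¹ y (A.inv∈ x x∈A) (S⊆A y y∈S)) (≟A-complete (begin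
          f (x⁻¹ ∘ₚ y)    ≡⟨ f-hom x⁻¹ y (A.inv∈ x x∈A) (S⊆A y y∈S) ⟩
          f x⁻¹ ∘ₚ f y    ≡⟨ cong (f x⁻¹ ∘ₚ_) fx≡fy ⟨
          f x⁻¹ ∘ₚ f x    ≡⟨ f-hom x⁻¹ x (A.inv∈ x x∈A) x∈A ⟨
          f (x⁻¹ ∘ₚ x)    ≡⟨ cong f (A.inverseˡ x x∈A) ⟩
          f idₚ           ≡⟨ f-id ⟩
          idₚ             ∎))))
      ∈coset⇒same-image : y ∈ coset x (kernel f A) → f x ≡ f y
      ∈coset⇒same-image y∈xK with (k , k∈K , refl) ← img-elim (x ∘ₚ_) (kernel f A) y∈xK = sym (begin
        f (x ∘ₚ k)    ≡⟨ f-hom x k x∈A (∧-elimˡ k∈K) ⟩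
        f x ∘ₚ f k    ≡⟨ cong (f x ∘ₚ_) (≟A-sound (∧-elimʳ {A k} k∈K)) ⟩
        f x ∘ₚ idₚ    ≡⟨ ∘ₚ-identityʳ (f x) ⟩
        f x           ∎)

    card-image : ∀ {S} → S ⊆ A → RightClosed S (kernel f A) → card S ≡ card (img f S) * card (kernel f A)
    card-image {S} S⊆A S-closed =
      fibre-count kernel-isPermGroup f (λ v v∈S → A.perm v (S⊆A v v∈S)) S-closed (kernel-separates S⊆A)

    kernel-normalizedBy : ∀ {B} → IsPermGroup B → B ⊆ A → Normalizes B (kernel f A)
    kernel-normalizedBy {B} B-grp B⊆A b k b∈B k∈K =
      (b ∘ₚ k) ∘ₚ b⁻¹ , ∧-intro {A ((b ∘ₚ k) ∘ₚ b⁻¹)} bkb⁻¹∈A (≟A-complete (begin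
        f ((b ∘ₚ k) ∘ₚ b⁻¹)     ≡⟨ f-hom (b ∘ₚ k) b⁻¹ (A.∘∈ b k b∈A k∈A) b⁻¹∈A ⟩
        f (b ∘ₚ k) ∘ₚ f b⁻¹     ≡⟨ cong (_∘ₚ f b⁻¹) (f-hom b k b∈A k∈A) ⟩
        (f b ∘ₚ f k) ∘ₚ f b⁻¹   ≡⟨ cong (λ z → (f b ∘ₚ z) ∘ₚ f b⁻¹) (≟A-sound (∧-elimʳ {A k} k∈K)) ⟩
        (f b ∘ₚ idₚ) ∘ₚ f b⁻¹   ≡⟨ cong (_∘ₚ f b⁻¹) (∘ₚ-identityʳ (f b)) ⟩
        f b ∘ₚ f b⁻¹            ≡⟨ f-hom b b⁻¹ b∈A b⁻¹∈A ⟨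
        f (b ∘ₚ b⁻¹)            ≡⟨ cong f (B.inverseʳ b b∈B) ⟩
        f idₚ                   ≡⟨ f-id ⟩
        idₚ                     ∎)) ,
      sym (∘ₚ-cancelʳ-inverse (b ∘ₚ k) b⁻¹ b (B.inverseˡ b b∈B))
      where
      module B = PermGroup B-grp
      b∈A = B⊆A b b∈B
      k∈A = ∧-elimˡ k∈K
      b⁻¹ = B.inv b b∈B
      b⁻¹∈A = B⊆A b⁻¹ (B.inv∈ b b∈B)
      bkb⁻¹∈A = A.∘∈ (b ∘ₚ k) b⁻¹ (A.∘∈ b k b∈A k∈A) b⁻¹∈A

    card-img-kernel· : ∀ {B} → B ⊆ A → card (img f (kernel f A · B)) ≡ card (img f B)
    card-img-kernel· {B} B⊆A = count-≐ {img f (K · B)} {img f B} fKB⊆fB fB⊆fKB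
      where
      K = kernel f A
      fB⊆fKB : img f B ⊆ img f (K · B)
      fB⊆fKB u u∈fB with (b , b∈B , refl) ← img-elim f B u∈fB =
        img-intro f (K · B) (⊆-·ʳ K B (PermGroup.id∈ kernel-isPermGroup) b b∈B)
      fKB⊆fB : img f (K · B) ⊆ img f B
      fKB⊆fB u u∈fKB with (v , v∈KB , refl) ← img-elim f (K · B) u∈fKB
                      with (k , b , k∈K , b∈B , refl) ← ·-elim K B v∈KB =
        subst (_∈ img f B) (sym (begin
          f (k ∘ₚ b)    ≡⟨ f-hom k b (∧-elimˡ k∈K) (B⊆A b b∈B) ⟩
          f k ∘ₚ f b    ≡⟨ cong (_∘ₚ f b) (≟A-sound (∧-elimʳ {A k} k∈K)) ⟩
          idₚ ∘ₚ f b    ≡⟨ ∘ₚ-identityˡ (f b) ⟩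
          f b           ∎)) (img-intro f B b∈B)

even-or-odd : ∀ m → Even m ⊎ Odd m
even-or-odd zero = inj₁ (0 , refl)
even-or-odd (suc m) with even-or-odd m
... | inj₁ (k , m≡2k) = inj₂ (k , cong suc m≡2k)
... | inj₂ (k , m≡1+2k) = inj₁ (suc k , trans (cong suc m≡1+2k) (cong suc (sym (+-suc k (k + 0)))))

even⇒¬odd : ∀ {m} → Even m → ¬ Odd m
even⇒¬odd {m} (k , m≡2k) (j , m≡1+2j) = 0≢1+n (begin
  0                   ≡⟨ m*n%n≡0 k 2 ⟨
  (k * 2) % 2         ≡⟨ cong (_% 2) (trans (*-comm k 2) (trans (sym m≡2k) (trans m≡1+2j (cong suc (*-comm 2 j))))) ⟩
  (1 + j * 2) % 2     ≡⟨ [m+kn]%n≡m%n 1 j 2 ⟩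
  1                   ∎)
  where open ≡-Reasoning

odd-*⁻ʳ : ∀ a b → Odd (a * b) → Odd b
odd-*⁻ʳ a b ab-odd with even-or-odd b
... | inj₂ b-odd = b-odd
... | inj₁ (k , refl) = contradiction ab-odd (even⇒¬odd (a * k , trans (sym (*-assoc a 2 k)) (trans (cong (_* k) (*-comm a 2)) (*-assoc 2 a k))))

odd-*⁻ˡ : ∀ a b → Odd (a * b) → Odd a
odd-*⁻ˡ a b ab-odd = odd-*⁻ʳ b a (subst Odd (*-comm a b) ab-odd)

module _ {n : ℕ} where
  open CountArr n
  open ≡-Reasoning

  oddIndex-intermediate : ∀ {A M B : Sub n} → IsPermGroup A → IsPermGroup M → IsPermGroup B → B ⊆ M → M ⊆ A
                        → OddIndex A B → OddIndex A M × OddIndex M B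
  oddIndex-intermediate {A} {M} {B} A-grp M-grp B-grp B⊆M M⊆A (m , A≡mB , m-odd) =
    (a , A≡aM , odd-*⁻ˡ a b (subst Odd m≡ab m-odd)) , (b , M≡bB , odd-*⁻ʳ a b (subst Odd m≡ab m-odd))
    where
    module A = PermGroup A-grp
    module M = PermGroup M-grp
    a = proj₁ (lagrange M-grp A.perm (subgroup-rightClosed A-grp M⊆A))
    A≡aM = proj₂ (lagrange M-grp A.perm (subgroup-rightClosed A-grp M⊆A))
    b = proj₁ (lagrange B-grp M.perm (subgroup-rightClosed M-grp B⊆M))
    M≡bB = proj₂ (lagrange B-grp M.perm (subgroup-rightClosed M-grp B⊆M))
    m≡ab : m ≡ a * b
    m≡ab = *-cancelʳ-≡ m (a * b) (card B) {{>-nonZero (count-pos idₚ (PermGroup.id∈ B-grp))}} (begin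
      m * card B        ≡⟨ A≡mB ⟨
      card A            ≡⟨ A≡aM ⟩
      a * card M        ≡⟨ cong (a *_) M≡bB ⟩
      a * (b * card B)  ≡⟨ *-assoc a b (card B) ⟨
      a * b * card B    ∎)

  oddIndex-normalized : ∀ {G H N : Sub n} → IsPermGroup G → IsPermGroup H → IsPermGroup N → H ⊆ G → N ⊆ G
                      → Normalizes H N → OddIndex G H → OddIndex N (N ∩ H)
  oddIndex-normalized {G} {H} {N} G-grp H-grp N-grp H⊆G N⊆G H-normalizes-N G:H-odd =
    b , N≡b[N∩H] , b-odd
    where
    NH-grp = ·-isPermGroup N-grp H-grp H-normalizes-N
    NH:H = proj₂ (oddIndex-intermediate G-grp NH-grp H-grp (⊆-·ʳ N H (PermGroup.id∈ N-grp)) (·-⊆ G-grp N⊆G H⊆G) G:H-odd)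
    b = proj₁ NH:H
    b-odd = proj₂ (proj₂ NH:H)
    N≡b[N∩H] : card N ≡ b * card (N ∩ H)
    N≡b[N∩H] = *-cancelʳ-≡ (card N) (b * card (N ∩ H)) (card H) {{>-nonZero (count-pos idₚ (PermGroup.id∈ H-grp))}} (begin
      card N * card H              ≡⟨ product-formula N-grp H-grp ⟩
      card (N · H) * card (N ∩ H)  ≡⟨ cong (_* card (N ∩ H)) (proj₁ (proj₂ NH:H)) ⟩
      b * card H * card (N ∩ H)    ≡⟨ xy∙z≈xz∙y b (card H) (card (N ∩ H)) ⟩
      b * card (N ∩ H) * card H    ∎)

  normalizes-∩ : ∀ {G H L : Sub n} → IsPermGroup G → IsPermGroup H → H ⊆ G → Normalizes H L → Normalizes H (L ∩ G)
  normalizes-∩ {G} {H} {L} G-grp H-grp H⊆G H-normalizes-L h x h∈H x∈L∩G =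
    let (y , y∈L , hx≡yh) = H-normalizes-L h x h∈H (∧-elimˡ {L x} x∈L∩G)
        h⁻¹ = H.inv h h∈H
        y≡hxh⁻¹ = trans (sym (∘ₚ-cancelʳ-inverse y h h⁻¹ (H.inverseʳ h h∈H))) (cong (_∘ₚ h⁻¹) (sym hx≡yh))
    in y , ∧-intro y∈L (subst (_∈ G) (sym y≡hxh⁻¹)
             (G.∘∈ (h ∘ₚ x) h⁻¹ (G.∘∈ h x (H⊆G h h∈H) (∧-elimʳ {L x} x∈L∩G)) (H⊆G h⁻¹ (H.inv∈ h h∈H)))) , hx≡yh
    where
    module G = PermGroup G-grp
    module H = PermGroup H-grp

  oddIndex-∩ : ∀ {G H L : Sub n} → IsPermGroup G → IsPermGroup H → IsPermGroup L → H ⊆ G → Normalizes H L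
             → OddIndex G H → OddIndex (L ∩ G) (L ∩ H)
  oddIndex-∩ {G} {H} {L} G-grp H-grp L-grp H⊆G H-normalizes-L G:H-odd =
    let (b , N≡b[N∩H] , b-odd) = oddIndex-normalized G-grp H-grp (∩-isPermGroup L-grp G-grp) H⊆G (λ v → ∧-elimʳ {L v})
                                   (normalizes-∩ G-grp H-grp H⊆G H-normalizes-L) G:H-odd
    in b , trans N≡b[N∩H] (cong (b *_) [L∩G]∩H≡L∩H) , b-odd
    where
    [L∩G]∩H≡L∩H : card ((L ∩ G) ∩ H) ≡ card (L ∩ H)
    [L∩G]∩H≡L∩H = count-≐ {(L ∩ G) ∩ H} {L ∩ H}
      (λ v v∈ → ∧-intro (∧-elimˡ {L v} (∧-elimˡ {(L ∩ G) v} v∈)) (∧-elimʳ {(L ∩ G) v} v∈))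
      (λ v v∈ → ∧-intro (∧-intro (∧-elimˡ v∈) (H⊆G v (∧-elimʳ {L v} v∈))) (∧-elimʳ {L v} v∈))

  oddIndex-image : ∀ {A B : Sub n} → IsPermGroup A → IsPermGroup B → B ⊆ A
                 → ∀ f → IsHomOn f A → f idₚ ≡ idₚ → OddIndex A B → OddIndex (img f A) (img f B)
  oddIndex-image {A} {B} A-grp B-grp B⊆A f f-hom f-id A:B-odd = c , fA≡c·fB , c-odd
    where
    open Hom A-grp f f-hom f-id
    K = kernel f A
    K-grp = kernel-isPermGroup
    KB-grp = ·-isPermGroup K-grp B-grp (kernel-normalizedBy B-grp B⊆A)
    KB⊆A = ·-⊆ A-grp (λ v → ∧-elimˡ {A v}) B⊆A
    A:KB = proj₁ (oddIndex-intermediate A-grp KB-grp B-grp (⊆-·ʳ K B (PermGroup.id∈ K-grp)) KB⊆A A:B-odd)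
    c = proj₁ A:KB
    c-odd = proj₂ (proj₂ A:KB)
    fA≡c·fB : card (img f A) ≡ c * card (img f B)
    fA≡c·fB = *-cancelʳ-≡ _ _ (card K) {{>-nonZero (count-pos idₚ (PermGroup.id∈ K-grp))}} (begin
      card (img f A) * card K              ≡⟨ card-image (λ _ p → p) (subgroup-rightClosed A-grp (λ v → ∧-elimˡ {A v})) ⟨
      card A                               ≡⟨ proj₁ (proj₂ A:KB) ⟩
      c * card (K · B)                     ≡⟨ cong (c *_) (card-image KB⊆A (subgroup-rightClosed KB-grp (⊆-·ˡ K B (PermGroup.id∈ B-grp)))) ⟩
      c * (card (img f (K · B)) * card K)  ≡⟨ cong (λ m → c * (m * card K)) (card-img-kernel· B⊆A) ⟩
      c * (card (img f B) * card K)        ≡⟨ *-assoc c _ _ ⟨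
      c * card (img f B) * card K          ∎)

  img-isPermGroup : ∀ {X : Sub n} → IsPermGroup X → ∀ f → IsHomOn f X → f idₚ ≡ idₚ
                  → (∀ x → x ∈ X → T (isPerm (f x))) → IsPermGroup (img f X)
  img-isPermGroup {X} X-grp f f-hom f-id f-perm = fX-perm , subst (_∈ img f X) f-id (img-intro f X X.id∈) , fX-closed
    where
    module X = PermGroup X-grp
    fX-perm : ∀ u → u ∈ img f X → T (isPerm u)
    fX-perm u u∈fX with (x , x∈X , refl) ← img-elim f X u∈fX = f-perm x x∈X
    fX-closed : ∀ u w → u ∈ img f X → w ∈ img f X → (u ∘ₚ w) ∈ img f X
    fX-closed u w u∈fX w∈fX with (x , x∈X , refl) ← img-elim f X u∈fX | (y , y∈X , refl) ← img-elim f X w∈fX =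
      subst (_∈ img f X) (f-hom x y x∈X y∈X) (img-intro f X (X.∘∈ x y x∈X y∈X))

  img-isNormalIn : ∀ {X Y : Sub n} → IsPermGroup X → ∀ f → IsHomOn f X → f idₚ ≡ idₚ
                 → (∀ x → x ∈ X → T (isPerm (f x))) → IsNormalIn Y X → IsNormalIn (img f Y) (img f X)
  img-isNormalIn {X} {Y} X-grp f f-hom f-id f-perm (Y-grp , Y⊆X , Y-normal) =
    img-isPermGroup Y-grp f (λ a b a∈Y b∈Y → f-hom a b (Y⊆X a a∈Y) (Y⊆X b b∈Y)) f-id (λ y y∈Y → f-perm y (Y⊆X y y∈Y)) ,
    fY⊆fX , fY-normal
    where
    fY⊆fX : img f Y ⊆ img f X
    fY⊆fX u u∈fY with (y , y∈Y , refl) ← img-elim f Y u∈fY = img-intro f X (Y⊆X y y∈Y)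
    fY-normal : ∀ a x → a ∈ img f X → x ∈ img f Y → ∃ λ x' → x' ∈ img f Y × a ∘ₚ x ≡ x' ∘ₚ a
    fY-normal a x a∈fX x∈fY with (a₀ , a₀∈X , refl) ← img-elim f X a∈fX | (y , y∈Y , refl) ← img-elim f Y x∈fY
                              with (y' , y'∈Y , a₀y≡y'a₀) ← Y-normal a₀ y a₀∈X y∈Y =
      f y' , img-intro f Y y'∈Y , (begin
        f a₀ ∘ₚ f y    ≡⟨ f-hom a₀ y a₀∈X (Y⊆X y y∈Y) ⟨
        f (a₀ ∘ₚ y)    ≡⟨ cong f a₀y≡y'a₀ ⟩
        f (y' ∘ₚ a₀)   ≡⟨ f-hom y' a₀ (Y⊆X y' y'∈Y) a₀∈X ⟩
        f y' ∘ₚ f a₀   ∎)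

-- Parity of inversions

module _ {n : ℕ} where
  open CountPairs n

  _<ᵇ_ : Fin n → Fin n → Bool
  i <ᵇ j = ⌊ i <? j ⌋

  <ᵇ-true : ∀ {i j} → i Fin.< j → i <ᵇ j ≡ true
  <ᵇ-true {i} {j} i<j with i <? j
  ... | yes _ = refl
  ... | no i≮j = ⊥-elim (i≮j i<j)

  <ᵇ-false : ∀ {i j} → ¬ i Fin.< j → i <ᵇ j ≡ false
  <ᵇ-false {i} {j} i≮j with i <? j
  ... | yes i<j = ⊥-elim (i≮j i<j)
  ... | no _ = refl

  <ᵇ-flip : ∀ {i j} → i ≢ j → j <ᵇ i ≡ not (i <ᵇ j)
  <ᵇ-flip {i} {j} i≢j with <-cmp i j
  ... | tri< i<j _ _ = trans (<ᵇ-false (<-asym i<j)) (cong not (sym (<ᵇ-true i<j)))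
  ... | tri≈ _ i≡j _ = ⊥-elim (i≢j i≡j)
  ... | tri> _ _ j<i = trans (<ᵇ-true j<i) (cong not (sym (<ᵇ-false (<-asym j<i))))

  Ascending : Fin n × Fin n → Bool
  Ascending (i , j) = i <ᵇ j

  Inverted : Arr n → Fin n × Fin n → Bool
  Inverted v (i , j) = (i <ᵇ j) ∧ (lookup v j <ᵇ lookup v i)

  inversions≡count : ∀ v → inversions v ≡ count (Inverted v)
  inversions≡count v = count-≐ (λ _ p → p) (λ _ p → p)

  sortedImage : Arr n → Fin n × Fin n → Fin n × Fin n
  sortedImage w (i , j) = if lookup w i <ᵇ lookup w j then (lookup w i , lookup w j) else (lookup w j , lookup w i)

  InvertedAfter : Arr n → Arr n → Fin n × Fin n → Bool
  InvertedAfter v w p = Ascending p ∧ Inverted v (sortedImage w p)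

  Inverted-∘ₚ : ∀ (v w : Arr n) → T (isPerm v) → T (isPerm w) → ∀ p →
                Inverted (v ∘ₚ w) p ≡ Inverted w p xor InvertedAfter v w p
  Inverted-∘ₚ v w v-perm w-perm (i , j) rewrite lookup-∘ₚ v w i | lookup-∘ₚ v w j with <-cmp i j
  ... | tri≈ i≮j _ _ rewrite <ᵇ-false i≮j = refl
  ... | tri> i≮j _ _ rewrite <ᵇ-false i≮j = refl
  ... | tri< i<j _ _ rewrite <ᵇ-true i<j with <-cmp (lookup w i) (lookup w j)
  ...   | tri< wi<wj _ _ rewrite <ᵇ-true wi<wj | <ᵇ-false (<-asym wi<wj) | <ᵇ-true wi<wj = refl
  ...   | tri≈ _ wi≡wj _ = ⊥-elim (<-irrefl (isPerm⇒injective w w-perm wi≡wj) i<j)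
  ...   | tri> _ _ wj<wi rewrite <ᵇ-false (<-asym wj<wi) | <ᵇ-true wj<wi
                               | <ᵇ-flip {lookup v (lookup w i)} {lookup v (lookup w j)}
                                   (λ e → <-irrefl (isPerm⇒injective w w-perm (isPerm⇒injective v v-perm e)) i<j) = refl

  sortedImage-injective : ∀ (w : Arr n) → T (isPerm w) → ∀ p q → T (Ascending p) → T (Ascending q)
                        → sortedImage w p ≡ sortedImage w q → p ≡ q
  sortedImage-injective w w-perm (i , j) (k , l) i<j k<l e
    with lookup w i <ᵇ lookup w j | lookup w k <ᵇ lookup w l
  ... | true  | true  = cong₂ _,_ (inj (,-injectiveˡ e)) (inj (,-injectiveʳ e))
    where inj = isPerm⇒injective w w-perm
  ... | false | false = cong₂ _,_ (inj (,-injectiveʳ e)) (inj (,-injectiveˡ e))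
    where inj = isPerm⇒injective w w-perm
  ... | true  | false = ⊥-elim (<-asym (toWitness i<j)
    (subst₂ Fin._<_ (sym (inj (,-injectiveʳ e))) (sym (inj (,-injectiveˡ e))) (toWitness k<l)))
    where inj = isPerm⇒injective w w-perm
  ... | false | true  = ⊥-elim (<-asym (toWitness i<j)
    (subst₂ Fin._<_ (sym (inj (,-injectiveˡ e))) (sym (inj (,-injectiveʳ e))) (toWitness k<l)))
    where inj = isPerm⇒injective w w-perm

  sortedImage-onto : ∀ (v w : Arr n) → T (isPerm w) → ∀ p → T (Inverted v p)
                   → ∃ λ q → T (InvertedAfter v w q) × sortedImage w q ≡ p
  sortedImage-onto v w w-perm (a , b) ab-inverted with inverse Sym-isPermGroup w w-perm
  ... | (u , _ , wu≡id , _) = from-cmp (<-cmp (lookup u a) (lookup u b))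
    where
    wua≡a : lookup w (lookup u a) ≡ a
    wua≡a = trans (sym (lookup-∘ₚ w u a)) (trans (cong (λ z → lookup z a) wu≡id) (lookup-idₚ a))
    wub≡b : lookup w (lookup u b) ≡ b
    wub≡b = trans (sym (lookup-∘ₚ w u b)) (trans (cong (λ z → lookup z b) wu≡id) (lookup-idₚ b))
    a<b : a Fin.< b
    a<b = toWitness (∧-elimˡ {a <ᵇ b} ab-inverted)
    from-cmp : _ → ∃ λ q → T (InvertedAfter v w q) × sortedImage w q ≡ (a , b)
    from-cmp (tri< ua<ub _ _) = (lookup u a , lookup u b) ,
      ∧-intro {lookup u a <ᵇ lookup u b} (fromWitness ua<ub) (subst (T ∘′ Inverted v) (sym sorted) ab-inverted) , sorted
      where
      sorted : sortedImage w (lookup u a , lookup u b) ≡ (a , b)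
      sorted rewrite wua≡a | wub≡b | <ᵇ-true a<b = refl
    from-cmp (tri≈ _ ua≡ub _) = ⊥-elim (<-irrefl (trans (sym wua≡a) (trans (cong (lookup w) ua≡ub) wub≡b)) a<b)
    from-cmp (tri> _ _ ub<ua) = (lookup u b , lookup u a) ,
      ∧-intro {lookup u b <ᵇ lookup u a} (fromWitness ub<ua) (subst (T ∘′ Inverted v) (sym sorted) ab-inverted) , sorted
      where
      sorted : sortedImage w (lookup u b , lookup u a) ≡ (a , b)
      sorted rewrite wua≡a | wub≡b | <ᵇ-false (<-asym a<b) = refl

  count-InvertedAfter : ∀ (v w : Arr n) → T (isPerm w) → count (InvertedAfter v w) ≡ count (Inverted v)
  count-InvertedAfter v w w-perm = sym (count-bijection (sortedImage w)
    (λ p q p-inv q-inv → sortedImage-injective w w-perm p q (∧-elimˡ p-inv) (∧-elimˡ q-inv))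
    (λ p p-inv → ∧-elimʳ {Ascending p} p-inv) (sortedImage-onto v w w-perm))

  inversions-∘ₚ : ∀ (v w : Arr n) → T (isPerm v) → T (isPerm w) →
                  inversions (v ∘ₚ w) + 2 * count (Inverted w ∩ₚ InvertedAfter v w) ≡ inversions v + inversions w
  inversions-∘ₚ v w v-perm w-perm = begin
    inversions (v ∘ₚ w) + 2 * count (Inverted w ∩ₚ InvertedAfter v w)
      ≡⟨ cong (_+ 2 * count (Inverted w ∩ₚ InvertedAfter v w))
              (trans (inversions≡count (v ∘ₚ w)) (count-≐ (λ p → subst T (Inverted-∘ₚ v w v-perm w-perm p))
                                                           (λ p → subst T (sym (Inverted-∘ₚ v w v-perm w-perm p))))) ⟩
    count (λ p → Inverted w p xor InvertedAfter v w p) + 2 * count (Inverted w ∩ₚ InvertedAfter v w)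
      ≡⟨ count-xor (Inverted w) (InvertedAfter v w) ⟩
    count (Inverted w) + count (InvertedAfter v w)
      ≡⟨ cong (count (Inverted w) +_) (count-InvertedAfter v w w-perm) ⟩
    count (Inverted w) + count (Inverted v)
      ≡⟨ +-comm (count (Inverted w)) (count (Inverted v)) ⟩
    inversions v + inversions w ∎
    where open ≡-Reasoning

even-+-double : ∀ x c y z → x + 2 * c ≡ y + z → y % 2 ≡ 0 → z % 2 ≡ 0 → x % 2 ≡ 0
even-+-double x c y z x+2c≡y+z y-even z-even = begin
  x % 2                              ≡⟨ [m+kn]%n≡m%n x c 2 ⟨
  (x + c * 2) % 2                    ≡⟨ cong (λ t → (x + t) % 2) (*-comm c 2) ⟩
  (x + 2 * c) % 2                    ≡⟨ cong (_% 2) (trans x+2c≡y+z (cong₂ _+_ (halve y y-even) (halve z z-even))) ⟩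
  (y / 2 * 2 + z / 2 * 2) % 2        ≡⟨ cong (_% 2) (*-distribʳ-+ 2 (y / 2) (z / 2)) ⟨
  ((y / 2 + z / 2) * 2) % 2          ≡⟨ m*n%n≡0 (y / 2 + z / 2) 2 ⟩
  0                                  ∎
  where
  open ≡-Reasoning
  halve : ∀ m → m % 2 ≡ 0 → m ≡ m / 2 * 2
  halve m m-even = trans (m≡m%n+[m/n]*n m 2) (cong (_+ m / 2 * 2) m-even)

Alt-isPermGroup : ∀ n → IsPermGroup (Altₙ n)
Alt-isPermGroup n = (λ v v∈A → ∧-elimˡ v∈A) , ∧-intro {isPerm (idₚ {n})} (isPerm-idₚ {n}) (fromWitness (cong (_% 2) inversions-idₚ)) , closed
  where
  open CountPairs n
  inversions-idₚ : inversions (idₚ {n}) ≡ 0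
  inversions-idₚ = trans (inversions≡count {n} idₚ) (count-empty λ { (i , j) i<j∧… →
    <-asym (toWitness (∧-elimˡ {i <ᵇ j} i<j∧…))
           (subst₂ Fin._<_ (lookup-idₚ j) (lookup-idₚ i) (toWitness (∧-elimʳ {i <ᵇ j} i<j∧…))) })
  closed : ∀ v w → v ∈ Altₙ n → w ∈ Altₙ n → (v ∘ₚ w) ∈ Altₙ n
  closed v w v∈A w∈A = ∧-intro {isPerm (v ∘ₚ w)} (isPerm-∘ₚ v w v-perm w-perm)
    (fromWitness (even-+-double (inversions (v ∘ₚ w)) (count (Inverted w ∩ₚ InvertedAfter v w)) (inversions v) (inversions w)
       (inversions-∘ₚ v w v-perm w-perm) (toWitness (∧-elimʳ {isPerm v} v∈A)) (toWitness (∧-elimʳ {isPerm w} w∈A))))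
    where
    v-perm = ∧-elimˡ {isPerm v} v∈A
    w-perm = ∧-elimˡ {isPerm w} w∈A

groupOf-isPermGroup : ∀ k n → IsPermGroup (groupOf k n)
groupOf-isPermGroup symmetric n = Sym-isPermGroup
groupOf-isPermGroup alternating n = Alt-isPermGroup n

-- Young subgroups and restriction to a block

module _ {n t : ℕ} (part : Fin n → Fin t) where
  open CountArr n
  open ≡-Reasoning

  private
    L = YoungSub part

  Young-preserves : ∀ v → v ∈ L → ∀ x → part (lookup v x) ≡ part x
  Young-preserves v v∈L x = toWitness (all-elim (λ x → ⌊ part (lookup v x) ≟ part x ⌋) {allFin n} (∧-elimʳ {isPerm v} v∈L) (∈-allFin x))

  Young-intro : ∀ v → T (isPerm v) → (∀ x → part (lookup v x) ≡ part x) → v ∈ L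
  Young-intro v v-perm v-preserves = ∧-intro {isPerm v} v-perm
    (all-intro (λ x → ⌊ part (lookup v x) ≟ part x ⌋) (allFin n) (λ x _ → fromWitness (v-preserves x)))

  Young-isPermGroup : IsPermGroup L
  Young-isPermGroup =
    (λ v v∈L → ∧-elimˡ {isPerm v} v∈L) ,
    Young-intro idₚ (isPerm-idₚ {n}) (λ x → cong part (lookup-idₚ x)) ,
    λ v w v∈L w∈L → Young-intro (v ∘ₚ w) (isPerm-∘ₚ v w (∧-elimˡ {isPerm v} v∈L) (∧-elimˡ {isPerm w} w∈L)) λ x → begin
      part (lookup (v ∘ₚ w) x)      ≡⟨ cong part (lookup-∘ₚ v w x) ⟩
      part (lookup v (lookup w x))  ≡⟨ Young-preserves v v∈L (lookup w x) ⟩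
      part (lookup w x)             ≡⟨ Young-preserves w w∈L x ⟩
      part x                        ∎

  restrict-inside : ∀ i v x → part x ≡ i → lookup (restrict part i v) x ≡ lookup v x
  restrict-inside i v x x∈Δᵢ with part x ≟ i | lookup∘tabulate (λ y → if ⌊ part y ≟ i ⌋ then lookup v y else y) x
  ... | yes _ | eq = eq
  ... | no x∉Δᵢ | _ = ⊥-elim (x∉Δᵢ x∈Δᵢ)

  restrict-outside : ∀ i v x → part x ≢ i → lookup (restrict part i v) x ≡ x
  restrict-outside i v x x∉Δᵢ with part x ≟ i | lookup∘tabulate (λ y → if ⌊ part y ≟ i ⌋ then lookup v y else y) x
  ... | yes x∈Δᵢ | _ = ⊥-elim (x∉Δᵢ x∈Δᵢ)
  ... | no _ | eq = eq

  restrict-∘ₚ : ∀ i v w → w ∈ L → restrict part i (v ∘ₚ w) ≡ restrict part i v ∘ₚ restrict part i w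
  restrict-∘ₚ i v w w∈L = Arr-ext λ x → pointwise x (part x ≟ i)
    where
    ρ = restrict part i
    pointwise : ∀ x → Dec (part x ≡ i) → lookup (ρ (v ∘ₚ w)) x ≡ lookup (ρ v ∘ₚ ρ w) x
    pointwise x (yes x∈Δᵢ) = begin
      lookup (ρ (v ∘ₚ w)) x        ≡⟨ restrict-inside i (v ∘ₚ w) x x∈Δᵢ ⟩
      lookup (v ∘ₚ w) x            ≡⟨ lookup-∘ₚ v w x ⟩
      lookup v (lookup w x)        ≡⟨ restrict-inside i v (lookup w x) (trans (Young-preserves w w∈L x) x∈Δᵢ) ⟨
      lookup (ρ v) (lookup w x)    ≡⟨ cong (lookup (ρ v)) (restrict-inside i w x x∈Δᵢ) ⟨
      lookup (ρ v) (lookup (ρ w) x) ≡⟨ lookup-∘ₚ (ρ v) (ρ w) x ⟨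
      lookup (ρ v ∘ₚ ρ w) x        ∎
    pointwise x (no x∉Δᵢ) = begin
      lookup (ρ (v ∘ₚ w)) x        ≡⟨ restrict-outside i (v ∘ₚ w) x x∉Δᵢ ⟩
      x                            ≡⟨ restrict-outside i v x x∉Δᵢ ⟨
      lookup (ρ v) x               ≡⟨ cong (lookup (ρ v)) (restrict-outside i w x x∉Δᵢ) ⟨
      lookup (ρ v) (lookup (ρ w) x) ≡⟨ lookup-∘ₚ (ρ v) (ρ w) x ⟨
      lookup (ρ v ∘ₚ ρ w) x        ∎

  restrict-idₚ : ∀ i → restrict part i idₚ ≡ idₚ
  restrict-idₚ i = Arr-ext λ x → pointwise x (part x ≟ i)
    where
    pointwise : ∀ x → Dec (part x ≡ i) → lookup (restrict part i idₚ) x ≡ lookup idₚ x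
    pointwise x (yes x∈Δᵢ) = restrict-inside i idₚ x x∈Δᵢ
    pointwise x (no x∉Δᵢ) = trans (restrict-outside i idₚ x x∉Δᵢ) (sym (lookup-idₚ x))

  restrict-isHomOn : ∀ i {A} → A ⊆ L → IsHomOn (restrict part i) A
  restrict-isHomOn i A⊆L v w _ w∈A = restrict-∘ₚ i v w (A⊆L w w∈A)

  restrict-isPerm : ∀ i v → v ∈ L → T (isPerm (restrict part i v))
  restrict-isPerm i v v∈L = injective⇒isPerm (restrict part i v) λ {x} {y} → by-blocks x y (part x ≟ i) (part y ≟ i)
    where
    v-inj = isPerm⇒injective v (∧-elimˡ {isPerm v} v∈L)
    by-blocks : ∀ x y → Dec (part x ≡ i) → Dec (part y ≡ i)
              → lookup (restrict part i v) x ≡ lookup (restrict part i v) y → x ≡ y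
    by-blocks x y (yes x∈Δᵢ) (yes y∈Δᵢ) e =
      v-inj (trans (sym (restrict-inside i v x x∈Δᵢ)) (trans e (restrict-inside i v y y∈Δᵢ)))
    by-blocks x y (yes x∈Δᵢ) (no y∉Δᵢ) e = ⊥-elim (y∉Δᵢ (begin
      part y               ≡⟨ cong part (trans (sym (restrict-outside i v y y∉Δᵢ)) (trans (sym e) (restrict-inside i v x x∈Δᵢ))) ⟩
      part (lookup v x)    ≡⟨ Young-preserves v v∈L x ⟩
      part x               ≡⟨ x∈Δᵢ ⟩
      i                    ∎))
    by-blocks x y (no x∉Δᵢ) (yes y∈Δᵢ) e = ⊥-elim (x∉Δᵢ (begin
      part x               ≡⟨ cong part (trans (sym (restrict-outside i v x x∉Δᵢ)) (trans e (restrict-inside i v y y∈Δᵢ))) ⟩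
      part (lookup v y)    ≡⟨ Young-preserves v v∈L y ⟩
      part y               ≡⟨ y∈Δᵢ ⟩
      i                    ∎))
    by-blocks x y (no x∉Δᵢ) (no y∉Δᵢ) e =
      trans (sym (restrict-outside i v x x∉Δᵢ)) (trans e (restrict-outside i v y y∉Δᵢ))

-- Normal subgroups and composition series

module _ {n : ℕ} where
  open CountArr n
  open ≡-Reasoning

  _≐_ : Sub n → Sub n → Set
  S ≐ R = S ⊆ R × R ⊆ S

  ≐-refl : ∀ {S : Sub n} → S ≐ S
  ≐-refl = (λ _ p → p) , (λ _ p → p)

  ∀? : ∀ {P : Arr n → Set} → (∀ v → Dec (P v)) → Dec (∀ v → P v)
  ∀? P? with all? P? (allArr n)
  ... | yes all-P = yes (λ v → All.lookup all-P (∈-allVecs n v))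
  ... | no ¬all-P = no (λ ∀P → ¬all-P (All.tabulate (λ {v} _ → ∀P v)))

  ∃? : ∀ {P : Arr n → Set} → (∀ v → Dec (P v)) → Dec (∃ λ v → P v)
  ∃? P? with any? P? (allArr n)
  ... | yes any-P = yes (Any.satisfied any-P)
  ... | no ¬any-P = no (λ (v , Pv) → ¬any-P (Any.map (λ { refl → Pv }) (∈-allVecs n v)))

  _⊆?_ : ∀ (S R : Sub n) → Dec (S ⊆ R)
  S ⊆? R = ∀? λ v → T? (S v) →-dec T? (R v)

  isPermGroup? : ∀ (S : Sub n) → Dec (IsPermGroup S)
  isPermGroup? S = ∀? (λ v → T? (S v) →-dec T? (isPerm v)) ×-dec (T? (S idₚ) ×-dec
                   ∀? (λ v → ∀? (λ w → T? (S v) →-dec (T? (S w) →-dec T? (S (v ∘ₚ w))))))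

  isNormalIn? : ∀ (N A : Sub n) → Dec (IsNormalIn N A)
  isNormalIn? N A = isPermGroup? N ×-dec (N ⊆? A ×-dec ∀? λ a → ∀? λ x → T? (A a) →-dec (T? (N x) →-dec
                    ∃? (λ x' → T? (N x') ×-dec (a ∘ₚ x) ≟ₚ (x' ∘ₚ a))))

  ⊈⇒witness : ∀ {S R : Sub n} → ¬ (S ⊆ R) → ∃ λ v → v ∈ S × ¬ v ∈ R
  ⊈⇒witness {S} {R} S⊈R with ∃? (λ v → T? (S v) ×-dec ¬? (T? (R v)))
  ... | yes (v , v∈S , v∉R) = v , v∈S , v∉R
  ... | no ∄ = ⊥-elim (S⊈R λ v v∈S → case T? (R v) of λ where
                  (yes v∈R) → v∈R
                  (no v∉R) → ⊥-elim (∄ (v , v∈S , v∉R)))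

  -- Every subset of Arr n, up to pointwise equality, as a table of truth values over allArr n.
  fromTable : List (Arr n) → List Bool → Sub n
  fromTable (x ∷ xs) (b ∷ bs) v = if ⌊ x ≟ₚ v ⌋ then b else fromTable xs bs v
  fromTable _ _ v = false

  tables : List (Arr n) → List (List Bool)
  tables [] = [] ∷ []
  tables (_ ∷ xs) = map (true ∷_) (tables xs) ++ map (false ∷_) (tables xs)

  ∈-tables : ∀ (S : Sub n) xs → map S xs ∈ˡ tables xs
  ∈-tables S [] = Any.here refl
  ∈-tables S (x ∷ xs) with S x
  ... | true = ∈-++⁺ˡ (∈-map⁺ (true ∷_) (∈-tables S xs))
  ... | false = ∈-++⁺ʳ (map (true ∷_) (tables xs)) (∈-map⁺ (false ∷_) (∈-tables S xs))

  fromTable-map : ∀ (S : Sub n) xs v → v ∈ˡ xs → fromTable xs (map S xs) v ≡ S v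
  fromTable-map S (x ∷ xs) v v∈ with x ≟ₚ v
  ... | yes refl = refl
  fromTable-map S (x ∷ xs) v (Any.here refl) | no x≢v = ⊥-elim (x≢v refl)
  fromTable-map S (x ∷ xs) v (Any.there v∈) | no _ = fromTable-map S xs v v∈

  allSubs : List (Sub n)
  allSubs = map (fromTable (allArr n)) (tables (allArr n))

  ∈-allSubs : ∀ S → ∃ λ S' → S' ∈ˡ allSubs × S' ≐ S
  ∈-allSubs S = fromTable (allArr n) (map S (allArr n)) ,
    ∈-map⁺ (fromTable (allArr n)) (∈-tables S (allArr n)) ,
    (λ v → subst T (fromTable-map S (allArr n) v (∈-allVecs n v))) ,
    (λ v → subst T (sym (fromTable-map S (allArr n) v (∈-allVecs n v))))

  isPermGroup-≐ : ∀ {S R : Sub n} → S ≐ R → IsPermGroup S → IsPermGroup R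
  isPermGroup-≐ (S⊆R , R⊆S) (S-perm , id∈S , S-closed) =
    (λ v v∈R → S-perm v (R⊆S v v∈R)) , S⊆R idₚ id∈S ,
    λ v w v∈R w∈R → S⊆R (v ∘ₚ w) (S-closed v w (R⊆S v v∈R) (R⊆S w w∈R))

  isNormalIn-≐ˡ : ∀ {N N' A : Sub n} → N ≐ N' → IsNormalIn N A → IsNormalIn N' A
  isNormalIn-≐ˡ (N⊆N' , N'⊆N) (N-grp , N⊆A , N-normal) =
    isPermGroup-≐ (N⊆N' , N'⊆N) N-grp , (λ v v∈N' → N⊆A v (N'⊆N v v∈N')) ,
    λ a x a∈A x∈N' → let (x' , x'∈N , ax≡x'a) = N-normal a x a∈A (N'⊆N x x∈N') in x' , N⊆N' x' x'∈N , ax≡x'a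

  isNormalIn-≐ʳ : ∀ {N A A' : Sub n} → A ≐ A' → IsNormalIn N A → IsNormalIn N A'
  isNormalIn-≐ʳ (A⊆A' , A'⊆A) (N-grp , N⊆A , N-normal) =
    N-grp , (λ v v∈N → A⊆A' v (N⊆A v v∈N)) , λ a x a∈A' → N-normal a x (A'⊆A a a∈A')

  maxNormal-≐ʳ : ∀ {B A A' : Sub n} → A ≐ A' → MaxNormal B A → MaxNormal B A'
  maxNormal-≐ʳ A≐A' (B-normal , (a , a∈A , a∉B) , B-maximal) =
    isNormalIn-≐ʳ A≐A' B-normal , (a , proj₁ A≐A' a a∈A , a∉B) ,
    λ N N-normal B⊆N → Data.Sum.map₂ (λ A⊆N v v∈A' → A⊆N v (proj₂ A≐A' v v∈A'))
                                      (B-maximal N (isNormalIn-≐ʳ (swap A≐A') N-normal) B⊆N)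

  compFactor-≐ : ∀ {Y X C D : Sub n} → Y ≐ X → CompFactor Y C D → ∃ λ C' → C' ≐ C × CompFactor X C' D
  compFactor-≐ {Y} {X} Y≐X (here B-max B-series) = X , swap Y≐X , here (maxNormal-≐ʳ Y≐X B-max) B-series
  compFactor-≐ {C = C} Y≐X (there Z-max factor) = C , ≐-refl , there (maxNormal-≐ʳ Y≐X Z-max) factor

  maxNormal-isPermGroup : ∀ {B A : Sub n} → MaxNormal B A → IsPermGroup B
  maxNormal-isPermGroup = proj₁ ∘ proj₁

  maxNormal-⊆ : ∀ {B A : Sub n} → MaxNormal B A → B ⊆ A
  maxNormal-⊆ B-max = proj₁ (proj₂ (proj₁ B-max))

  maxNormal-card : ∀ {B A : Sub n} → MaxNormal B A → card B < card A
  maxNormal-card {B} {A} B-max = let (a , a∈A , a∉B) = proj₁ (proj₂ B-max) in count-< (maxNormal-⊆ B-max) a a∈A a∉B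

  StrictlyBetween : Sub n → Sub n → Sub n → Set
  StrictlyBetween Y X N = IsNormalIn N X × Y ⊆ N × ¬ (N ⊆ Y) × ¬ (X ⊆ N)

  strictlyBetween? : ∀ Y X N → Dec (StrictlyBetween Y X N)
  strictlyBetween? Y X N = isNormalIn? N X ×-dec (Y ⊆? N ×-dec (¬? (N ⊆? Y) ×-dec ¬? (X ⊆? N)))

  -- Climb through normal subgroups strictly between Y and X; card strictly increases, so this stops.
  maxNormal-above : ∀ {X Y : Sub n} → IsNormalIn Y X → ¬ (X ⊆ Y) → ∃ λ M → MaxNormal M X × Y ⊆ M
  maxNormal-above {X} {Y} = climb (card X) Y (m≤n+m (card X) (card Y))
    where
    climb : ∀ fuel Y → card X ≤ card Y + fuel → IsNormalIn Y X → ¬ (X ⊆ Y) → ∃ λ M → MaxNormal M X × Y ⊆ M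
    climb fuel Y X≤Y+fuel Y-normal X⊈Y with any? (strictlyBetween? Y X) allSubs
    ... | no none-between = Y , (Y-normal , ⊈⇒witness X⊈Y , Y-maximal) , (λ _ p → p)
      where
      Y-maximal : ∀ N → IsNormalIn N X → Y ⊆ N → N ⊆ Y ⊎ X ⊆ N
      Y-maximal N N-normal Y⊆N with N ⊆? Y | X ⊆? N
      ... | yes N⊆Y | _ = inj₁ N⊆Y
      ... | no _ | yes X⊆N = inj₂ X⊆N
      ... | no N⊈Y | no X⊈N = let (N' , N'∈ , N'≐N) = ∈-allSubs N in ⊥-elim (none-between (Any.map (λ { refl →
              isNormalIn-≐ˡ (swap N'≐N) N-normal , (λ v v∈Y → proj₂ N'≐N v (Y⊆N v v∈Y)) ,
              (λ N'⊆Y → N⊈Y λ v v∈N → N'⊆Y v (proj₂ N'≐N v v∈N)) , (λ X⊆N' → X⊈N λ v v∈X → proj₁ N'≐N v (X⊆N' v v∈X)) }) N'∈))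
    ... | yes some-between with (N , N-normal , Y⊆N , N⊈Y , X⊈N) ← Any.satisfied some-between =
      let (v , v∈N , v∉Y) = ⊈⇒witness N⊈Y
          Y<N = count-< Y⊆N v v∈N v∉Y
      in case-fuel fuel X≤Y+fuel Y<N
      where
      case-fuel : ∀ fuel → card X ≤ card Y + fuel → card Y < card N → ∃ λ M → MaxNormal M X × Y ⊆ M
      case-fuel zero X≤Y+0 Y<N = ⊥-elim (<⇒≱ (<-≤-trans Y<N (count-mono (proj₁ (proj₂ N-normal))))
                                                (≤-trans X≤Y+0 (≤-reflexive (+-identityʳ (card Y)))))
      case-fuel (suc fuel) X≤Y+1+fuel Y<N =
        let (M , M-max , N⊆M) = climb fuel N (≤-trans X≤Y+1+fuel (≤-trans (≤-reflexive (+-suc (card Y) fuel)) (+-monoˡ-≤ fuel Y<N)))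
                                      N-normal X⊈N
        in M , M-max , λ v v∈Y → N⊆M v (Y⊆N v v∈Y)

  trivial : Sub n
  trivial v = v ≟A idₚ

  trivial-isNormalIn : ∀ {X : Sub n} → IsPermGroup X → IsNormalIn trivial X
  trivial-isNormalIn {X} X-grp =
    ((λ v v≡id → subst (T ∘ isPerm) (sym (≟A-sound v≡id)) (isPerm-idₚ {n})) , ≟A-complete {n} refl ,
     λ v w v≡id w≡id → ≟A-complete (trans (cong₂ _∘ₚ_ (≟A-sound v≡id) (≟A-sound w≡id)) (∘ₚ-identityˡ idₚ))) ,
    (λ v v≡id → subst (_∈ X) (sym (≟A-sound v≡id)) (PermGroup.id∈ X-grp)) ,
    λ a x _ x≡id → idₚ , ≟A-complete {n} refl ,
      trans (cong (a ∘ₚ_) (≟A-sound x≡id)) (trans (∘ₚ-identityʳ a) (sym (∘ₚ-identityˡ a)))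

  isTrivial? : ∀ (X : Sub n) → Dec (IsTrivial X)
  isTrivial? X = ∀? λ v → T? (X v) →-dec (v ≟ₚ idₚ)

  compSeries : ∀ {X : Sub n} → IsPermGroup X → CompSeries X
  compSeries {X} = go (suc (card X)) (n<1+n _)
    where
    go : ∀ fuel {X} → card X < fuel → IsPermGroup X → CompSeries X
    go zero () _
    go (suc fuel) {X} X<fuel X-grp with isTrivial? X
    ... | yes X-trivial = done X-trivial
    ... | no X-nontrivial =
      let (M , M-max , _) = maxNormal-above (trivial-isNormalIn X-grp) (λ X⊆1 → X-nontrivial λ v v∈X → ≟A-sound (X⊆1 v v∈X))
      in step M M-max (go fuel (<-≤-trans (maxNormal-card M-max) (≤-pred X<fuel)) (maxNormal-isPermGroup M-max))

  -- Refine X ▷ Y to a chain of maximal normal subgroups ending at Y, and append the series of Y.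
  compFactor-normal : ∀ {X Y C D : Sub n} → IsNormalIn Y X → CompFactor Y C D → ∃ λ C' → C' ≐ C × CompFactor X C' D
  compFactor-normal {X} = go (suc (card X)) (n<1+n _)
    where
    go : ∀ fuel {X Y C D} → card X < fuel → IsNormalIn Y X → CompFactor Y C D → ∃ λ C' → C' ≐ C × CompFactor X C' D
    go zero () _ _
    go (suc fuel) {X} {Y} X<fuel Y-normal factor with X ⊆? Y
    ... | yes X⊆Y = compFactor-≐ (proj₁ (proj₂ Y-normal) , X⊆Y) factor
    ... | no X⊈Y =
      let (M , M-max , Y⊆M) = maxNormal-above Y-normal X⊈Y
          (C' , C'≐C , factor') = go fuel (<-≤-trans (maxNormal-card M-max) (≤-pred X<fuel))
                                    (proj₁ Y-normal , Y⊆M , λ a x a∈M → proj₂ (proj₂ Y-normal) a x (maxNormal-⊆ M-max a a∈M)) factor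
      in C' , C'≐C , there M-max factor'

  quotIso-≐ : ∀ {A B C C' D : Sub n} → QuotIso A B C D → C ≐ C' → QuotIso A B C' D
  quotIso-≐ (f , f∈C , f-hom , f-ker , f-onto) (C⊆C' , C'⊆C) =
    f , (λ a a∈A → C⊆C' (f a) (f∈C a a∈A)) , f-hom , f-ker , (λ c c∈C' → f-onto c (C'⊆C c c∈C'))

  -- The correspondence theorem for A/B ≅ C/D: normal subgroups of C above D pull back to normal subgroups of A above B.
  module Correspondence {A B C D : Sub n} (A-grp : IsPermGroup A) (C-grp : IsPermGroup C)
                        (D-normal : IsNormalIn D C) (iso : QuotIso A B C D) where
    private
      module A = PermGroup A-grp
      module C = PermGroup C-grp
      module D = PermGroup (proj₁ D-normal)
      f = proj₁ iso
      f∈C = proj₁ (proj₂ iso)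
      f-hom = proj₁ (proj₂ (proj₂ iso))
      f-ker = proj₁ (proj₂ (proj₂ (proj₂ iso)))
      f-onto = proj₂ (proj₂ (proj₂ (proj₂ iso)))

    preimage : Sub n → Sub n
    preimage N v = A v ∧ N (f v)

    module _ {N : Sub n} (N-normal : IsNormalIn N C) (D⊆N : D ⊆ N) where
      private module N = PermGroup (proj₁ N-normal)

      f-id∈ : f idₚ ∈ N
      f-id∈ with (d , d∈D , fid≡fid·fid·d) ← f-hom idₚ idₚ A.id∈ A.id∈ =
        subst (_∈ N) (sym fid≡d⁻¹) (D⊆N _ (D.inv∈ d d∈D))
        where
        fid = f idₚ
        id≡fid·d : idₚ ≡ fid ∘ₚ d
        id≡fid·d = ∘ₚ-cancelˡ fid (C.perm fid (f∈C idₚ A.id∈))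
          (trans (∘ₚ-identityʳ fid) (trans (cong f (sym (∘ₚ-identityˡ idₚ))) (trans fid≡fid·fid·d (∘ₚ-assoc fid fid d))))
        fid≡d⁻¹ : fid ≡ D.inv d d∈D
        fid≡d⁻¹ = sym (trans (sym (∘ₚ-identityˡ (D.inv d d∈D)))
                       (trans (cong (_∘ₚ D.inv d d∈D) id≡fid·d) (∘ₚ-cancelʳ-inverse fid d (D.inv d d∈D) (D.inverseʳ d d∈D))))

      preimage-isPermGroup : IsPermGroup (preimage N)
      preimage-isPermGroup =
        (λ v v∈P → A.perm v (∧-elimˡ v∈P)) , ∧-intro {A idₚ} A.id∈ f-id∈ ,
        λ v w v∈P w∈P →
          let (d , d∈D , f[vw]≡fv·fw·d) = f-hom v w (∧-elimˡ v∈P) (∧-elimˡ w∈P)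
          in ∧-intro {A (v ∘ₚ w)} (A.∘∈ v w (∧-elimˡ v∈P) (∧-elimˡ w∈P))
               (subst (_∈ N) (sym f[vw]≡fv·fw·d)
                 (N.∘∈ _ d (N.∘∈ (f v) (f w) (∧-elimʳ {A v} v∈P) (∧-elimʳ {A w} w∈P)) (D⊆N d d∈D)))

      -- For x' = a x a⁻¹: f x' · f a = f a · (f x · d₂ · d₁⁻¹), and N ⊴ C moves f a back to the right.
      preimage-normal : ∀ a x → a ∈ A → x ∈ preimage N → ∃ λ x' → x' ∈ preimage N × a ∘ₚ x ≡ x' ∘ₚ a
      preimage-normal a x a∈A x∈P = x' , ∧-intro {A x'} x'∈A fx'∈N , sym x'a≡ax
        where
        a⁻¹ = A.inv a a∈A
        x∈A = ∧-elimˡ x∈P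
        x' = (a ∘ₚ x) ∘ₚ a⁻¹
        x'∈A = A.∘∈ (a ∘ₚ x) a⁻¹ (A.∘∈ a x a∈A x∈A) (A.inv∈ a a∈A)
        x'a≡ax : x' ∘ₚ a ≡ a ∘ₚ x
        x'a≡ax = ∘ₚ-cancelʳ-inverse (a ∘ₚ x) a⁻¹ a (A.inverseˡ a a∈A)
        hom₁ = f-hom x' a x'∈A a∈A
        d₁ = proj₁ hom₁
        d₁∈D = proj₁ (proj₂ hom₁)
        d₁⁻¹ = D.inv d₁ d₁∈D
        hom₂ = f-hom a x a∈A x∈A
        d₂ = proj₁ hom₂
        z = (f x ∘ₚ d₂) ∘ₚ d₁⁻¹
        z∈N : z ∈ N
        z∈N = N.∘∈ _ _ (N.∘∈ (f x) d₂ (∧-elimʳ {A x} x∈P) (D⊆N d₂ (proj₁ (proj₂ hom₂)))) (D⊆N d₁⁻¹ (D.inv∈ d₁ d₁∈D))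
        conj = proj₂ (proj₂ N-normal) (f a) z (f∈C a a∈A) z∈N
        y = proj₁ conj
        fx'·fa≡y·fa : f x' ∘ₚ f a ≡ y ∘ₚ f a
        fx'·fa≡y·fa = begin
          f x' ∘ₚ f a                      ≡⟨ ∘ₚ-cancelʳ-inverse (f x' ∘ₚ f a) d₁ d₁⁻¹ (D.inverseʳ d₁ d₁∈D) ⟨
          ((f x' ∘ₚ f a) ∘ₚ d₁) ∘ₚ d₁⁻¹     ≡⟨ cong (_∘ₚ d₁⁻¹) (proj₂ (proj₂ hom₁)) ⟨
          f (x' ∘ₚ a) ∘ₚ d₁⁻¹              ≡⟨ cong (λ w → f w ∘ₚ d₁⁻¹) x'a≡ax ⟩
          f (a ∘ₚ x) ∘ₚ d₁⁻¹               ≡⟨ cong (_∘ₚ d₁⁻¹) (proj₂ (proj₂ hom₂)) ⟩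
          ((f a ∘ₚ f x) ∘ₚ d₂) ∘ₚ d₁⁻¹     ≡⟨ cong (_∘ₚ d₁⁻¹) (∘ₚ-assoc (f a) (f x) d₂) ⟩
          (f a ∘ₚ (f x ∘ₚ d₂)) ∘ₚ d₁⁻¹     ≡⟨ ∘ₚ-assoc (f a) (f x ∘ₚ d₂) d₁⁻¹ ⟩
          f a ∘ₚ z                         ≡⟨ proj₂ (proj₂ conj) ⟩
          y ∘ₚ f a                         ∎
        fx'∈N : f x' ∈ N
        fx'∈N = subst (_∈ N) (sym (∘ₚ-cancelʳ (f a) (C.perm (f a) (f∈C a a∈A)) fx'·fa≡y·fa)) (proj₁ (proj₂ conj))

      preimage-isNormalIn : IsNormalIn (preimage N) A
      preimage-isNormalIn = preimage-isPermGroup , (λ v → ∧-elimˡ {A v}) , preimage-normal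

      B⊆preimage : B ⊆ A → B ⊆ preimage N
      B⊆preimage B⊆A b b∈B = ∧-intro {A b} (B⊆A b b∈B) (D⊆N (f b) (proj₂ (f-ker b (B⊆A b b∈B)) b∈B))

      preimage⊆B⇒N⊆D : preimage N ⊆ B → N ⊆ D
      preimage⊆B⇒N⊆D P⊆B c c∈N with (a , a∈A , d , d∈D , c≡fa·d) ← f-onto c (proj₁ (proj₂ N-normal) c c∈N) =
        subst (_∈ D) (sym c≡fa·d) (D.∘∈ (f a) d (proj₂ (f-ker a a∈A) (P⊆B a (∧-intro {A a} a∈A fa∈N))) d∈D)
        where
        fa∈N : f a ∈ N
        fa∈N = subst (_∈ N) (trans (cong (_∘ₚ D.inv d d∈D) c≡fa·d) (∘ₚ-cancelʳ-inverse (f a) d (D.inv d d∈D) (D.inverseʳ d d∈D)))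
                 (N.∘∈ c (D.inv d d∈D) c∈N (D⊆N _ (D.inv∈ d d∈D)))

      A⊆preimage⇒C⊆N : A ⊆ preimage N → C ⊆ N
      A⊆preimage⇒C⊆N A⊆P c c∈C with (a , a∈A , d , d∈D , c≡fa·d) ← f-onto c c∈C =
        subst (_∈ N) (sym c≡fa·d) (N.∘∈ (f a) d (∧-elimʳ {A a} (A⊆P a a∈A)) (D⊆N d d∈D))

    maxNormal-quotIso : MaxNormal B A → MaxNormal D C
    maxNormal-quotIso (B-normal , (a , a∈A , a∉B) , B-maximal) =
      D-normal , (f a , f∈C a a∈A , λ fa∈D → a∉B (proj₁ (f-ker a a∈A) fa∈D)) ,
      λ N N-normal D⊆N → Data.Sum.map (preimage⊆B⇒N⊆D N-normal D⊆N) (A⊆preimage⇒C⊆N N-normal D⊆N)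
        (B-maximal (preimage N) (preimage-isNormalIn N-normal D⊆N) (B⊆preimage N-normal D⊆N (proj₁ (proj₂ B-normal))))

  isNormalIn-swapʳ : ∀ {B X : Sub n} → IsPermGroup X → IsNormalIn B X → ∀ x b → x ∈ X → b ∈ B
                   → ∃ λ b' → b' ∈ B × b ∘ₚ x ≡ x ∘ₚ b'
  isNormalIn-swapʳ {B} {X} X-grp (_ , _ , B-normal) x b x∈X b∈B = b' , proj₁ (proj₂ conj) , sym (begin
      x ∘ₚ b'                      ≡⟨ cong (x ∘ₚ_) (∘ₚ-cancelʳ-inverse b' x⁻¹ x (X.inverseˡ x x∈X)) ⟨
      x ∘ₚ ((b' ∘ₚ x⁻¹) ∘ₚ x)      ≡⟨ cong (λ z → x ∘ₚ (z ∘ₚ x)) (proj₂ (proj₂ conj)) ⟨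
      x ∘ₚ ((x⁻¹ ∘ₚ b) ∘ₚ x)       ≡⟨ ∘ₚ-assoc x (x⁻¹ ∘ₚ b) x ⟨
      (x ∘ₚ (x⁻¹ ∘ₚ b)) ∘ₚ x       ≡⟨ cong (_∘ₚ x) (∘ₚ-cancelˡ-inverse x x⁻¹ b (X.inverseʳ x x∈X)) ⟩
      b ∘ₚ x                       ∎)
    where
    module X = PermGroup X-grp
    x⁻¹ = X.inv x x∈X
    conj = B-normal x⁻¹ b (X.inv∈ x x∈X) b∈B
    b' = proj₁ conj

  ∩-isNormalIn : ∀ {M B X : Sub n} → IsPermGroup M → M ⊆ X → IsNormalIn B X → IsNormalIn (M ∩ B) M
  ∩-isNormalIn {M} {B} M-grp M⊆X (B-grp , _ , B-normal) = ∩-isPermGroup M-grp B-grp , (λ v → ∧-elimˡ {M v}) , MB-normal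
    where
    module M = PermGroup M-grp
    MB-normal : ∀ a x → a ∈ M → x ∈ (M ∩ B) → ∃ λ x' → x' ∈ (M ∩ B) × a ∘ₚ x ≡ x' ∘ₚ a
    MB-normal a x a∈M x∈MB =
      let (x' , x'∈B , ax≡x'a) = B-normal a x (M⊆X a a∈M) (∧-elimʳ {M x} x∈MB)
          a⁻¹ = M.inv a a∈M
          x'≡axa⁻¹ = trans (sym (∘ₚ-cancelʳ-inverse x' a a⁻¹ (M.inverseʳ a a∈M))) (cong (_∘ₚ a⁻¹) (sym ax≡x'a))
      in x' , ∧-intro {M x'} (subst (_∈ M) (sym x'≡axa⁻¹)
                (M.∘∈ (a ∘ₚ x) a⁻¹ (M.∘∈ a x a∈M (∧-elimˡ {M x} x∈MB)) (M.inv∈ a a∈M))) x'∈B , ax≡x'a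

-- Composition factors of subgroups of a Young subgroup

transition : ∀ (P : ℕ → Set) → (∀ l → Dec (P l)) → ∀ t → P 0 → ¬ P t → ∃ λ l → l < t × P l × ¬ P (suc l)
transition P P? zero P0 ¬Pt = contradiction P0 ¬Pt
transition P P? (suc t) P0 ¬P[1+t] with P? t
... | yes Pt = t , n<1+n t , Pt , ¬P[1+t]
... | no ¬Pt = let (l , l<t , Pl , ¬P[1+l]) = transition P P? t P0 ¬Pt in l , m≤n⇒m≤1+n l<t , Pl , ¬P[1+l]

module _ {n t : ℕ} (part : Fin n → Fin t) {X : Sub n} (X-grp : IsPermGroup X) (X⊆L : X ⊆ YoungSub part) where
  open CountArr n
  open ≡-Reasoning
  private module X = PermGroup X-grp

  -- The elements of X acting trivially on the blocks Δⱼ with j < l.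
  Fixing : ℕ → Sub n
  Fixing l v = X v ∧ all (λ j → not ⌊ toℕ j ℕ.<? l ⌋ ∨ (restrict part j v ≟A idₚ)) (allFin t)

  Fixing-intro : ∀ l v → v ∈ X → (∀ j → toℕ j < l → restrict part j v ≡ idₚ) → v ∈ Fixing l
  Fixing-intro l v v∈X v-fixes = ∧-intro {X v} v∈X (all-intro _ (allFin t) λ j _ → fixes j)
    where
    fixes : ∀ j → T (not ⌊ toℕ j ℕ.<? l ⌋ ∨ (restrict part j v ≟A idₚ))
    fixes j with toℕ j ℕ.<? l
    ... | yes j<l = ≟A-complete (v-fixes j j<l)
    ... | no _ = _

  Fixing-elim : ∀ l v → v ∈ Fixing l → ∀ j → toℕ j < l → restrict part j v ≡ idₚ
  Fixing-elim l v v∈F j j<l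
    with ∨-elim {not ⌊ toℕ j ℕ.<? l ⌋} (all-elim (λ j → not ⌊ toℕ j ℕ.<? l ⌋ ∨ (restrict part j v ≟A idₚ)) {allFin t}
                                                  (∧-elimʳ {X v} v∈F) (∈-allFin j))
  ... | inj₁ j≮l = contradiction (fromWitness j<l) (not-elim j≮l)
  ... | inj₂ ρv≡id = ≟A-sound ρv≡id

  Fixing-⊆ : ∀ l → Fixing l ⊆ X
  Fixing-⊆ l v = ∧-elimˡ {X v}

  Fixing-isNormalIn : ∀ l → IsNormalIn (Fixing l) X
  Fixing-isNormalIn l = F-grp , Fixing-⊆ l , F-normal
    where
    ρ-hom : ∀ j v w → w ∈ X → restrict part j (v ∘ₚ w) ≡ restrict part j v ∘ₚ restrict part j w
    ρ-hom j v w w∈X = restrict-∘ₚ part j v w (X⊆L w w∈X)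
    F-grp : IsPermGroup (Fixing l)
    F-grp = (λ v v∈F → X.perm v (Fixing-⊆ l v v∈F)) , Fixing-intro l idₚ X.id∈ (λ j _ → restrict-idₚ part j) ,
      λ v w v∈F w∈F → Fixing-intro l (v ∘ₚ w) (X.∘∈ v w (Fixing-⊆ l v v∈F) (Fixing-⊆ l w w∈F)) λ j j<l →
        trans (ρ-hom j v w (Fixing-⊆ l w w∈F))
              (trans (cong₂ _∘ₚ_ (Fixing-elim l v v∈F j j<l) (Fixing-elim l w w∈F j j<l)) (∘ₚ-identityˡ idₚ))
    F-normal : ∀ a x → a ∈ X → x ∈ Fixing l → ∃ λ x' → x' ∈ Fixing l × a ∘ₚ x ≡ x' ∘ₚ a
    F-normal a x a∈X x∈F = x' , Fixing-intro l x' x'∈X x'-fixes , sym (∘ₚ-cancelʳ-inverse (a ∘ₚ x) a⁻¹ a (X.inverseˡ a a∈X))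
      where
      a⁻¹ = X.inv a a∈X
      a⁻¹∈X = X.inv∈ a a∈X
      x∈X = Fixing-⊆ l x x∈F
      x' = (a ∘ₚ x) ∘ₚ a⁻¹
      x'∈X = X.∘∈ (a ∘ₚ x) a⁻¹ (X.∘∈ a x a∈X x∈X) a⁻¹∈X
      x'-fixes : ∀ j → toℕ j < l → restrict part j x' ≡ idₚ
      x'-fixes j j<l = begin
        ρ x'                   ≡⟨ ρ-hom j (a ∘ₚ x) a⁻¹ a⁻¹∈X ⟩
        ρ (a ∘ₚ x) ∘ₚ ρ a⁻¹    ≡⟨ cong (_∘ₚ ρ a⁻¹) (ρ-hom j a x x∈X) ⟩
        (ρ a ∘ₚ ρ x) ∘ₚ ρ a⁻¹  ≡⟨ cong (λ z → (ρ a ∘ₚ z) ∘ₚ ρ a⁻¹) (Fixing-elim l x x∈F j j<l) ⟩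
        (ρ a ∘ₚ idₚ) ∘ₚ ρ a⁻¹  ≡⟨ cong (_∘ₚ ρ a⁻¹) (∘ₚ-identityʳ (ρ a)) ⟩
        ρ a ∘ₚ ρ a⁻¹           ≡⟨ ρ-hom j a a⁻¹ a⁻¹∈X ⟨
        ρ (a ∘ₚ a⁻¹)           ≡⟨ cong ρ (X.inverseʳ a a∈X) ⟩
        ρ idₚ                  ≡⟨ restrict-idₚ part j ⟩
        idₚ                    ∎
        where ρ = restrict part j

  Fixing-trivial : ∀ v → v ∈ Fixing t → v ≡ idₚ
  Fixing-trivial v v∈F = Arr-ext λ x → begin
    lookup v x                          ≡⟨ restrict-inside part (part x) v x refl ⟨
    lookup (restrict part (part x) v) x ≡⟨ cong (λ w → lookup w x) (Fixing-elim t v v∈F (part x) (toℕ<n (part x))) ⟩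
    lookup idₚ x                        ∎

  module Transition {B : Sub n} (B-max : MaxNormal B X) where
    private
      B-normal = proj₁ B-max
      B-grp = proj₁ B-normal
      B⊆X = proj₁ (proj₂ B-normal)
      module B = PermGroup B-grp

    FixingB-isNormalIn : ∀ l → IsNormalIn (Fixing l · B) X
    FixingB-isNormalIn l = KB-grp , ·-⊆ X-grp (Fixing-⊆ l) B⊆X , KB-normal
      where
      K-normal = Fixing-isNormalIn l
      KB-grp = ·-isPermGroup (proj₁ K-normal) B-grp (λ b k b∈B → proj₂ (proj₂ K-normal) b k (B⊆X b b∈B))
      KB-normal : ∀ a u → a ∈ X → u ∈ (Fixing l · B) → ∃ λ u' → u' ∈ (Fixing l · B) × a ∘ₚ u ≡ u' ∘ₚ a
      KB-normal a u a∈X u∈KB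
        with (k , b , k∈K , b∈B , refl) ← ·-elim (Fixing l) B u∈KB
        with (k' , k'∈K , ak≡k'a) ← proj₂ (proj₂ K-normal) a k a∈X k∈K
           | (b' , b'∈B , ab≡b'a) ← proj₂ (proj₂ B-normal) a b a∈X b∈B =
        k' ∘ₚ b' , ·-intro (Fixing l) B k'∈K b'∈B , (begin
          a ∘ₚ (k ∘ₚ b)     ≡⟨ ∘ₚ-assoc a k b ⟨
          (a ∘ₚ k) ∘ₚ b     ≡⟨ cong (_∘ₚ b) ak≡k'a ⟩
          (k' ∘ₚ a) ∘ₚ b    ≡⟨ ∘ₚ-assoc k' a b ⟩
          k' ∘ₚ (a ∘ₚ b)    ≡⟨ cong (k' ∘ₚ_) ab≡b'a ⟩
          k' ∘ₚ (b' ∘ₚ a)   ≡⟨ ∘ₚ-assoc k' b' a ⟨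
          (k' ∘ₚ b') ∘ₚ a   ∎)

    Covers : ℕ → Set
    Covers l = X ⊆ (Fixing l · B)

    covers-0 : Covers 0
    covers-0 v v∈X = ⊆-·ˡ (Fixing 0) B B.id∈ v (Fixing-intro 0 v v∈X λ _ ())

    ¬covers-t : ¬ Covers t
    ¬covers-t X⊆FB with (a , a∈X , a∉B) ← proj₁ (proj₂ B-max)
                   with (k , b , k∈F , b∈B , kb≡a) ← ·-elim (Fixing t) B (X⊆FB a a∈X) =
      a∉B (subst (_∈ B) (trans (trans (sym (∘ₚ-identityˡ b)) (cong (_∘ₚ b) (sym (Fixing-trivial k k∈F)))) kb≡a) b∈B)

    covers? : ∀ l → Dec (Covers l)
    covers? l = X ⊆? (Fixing l · B)

    opaque
      transition-point : ∃ λ l → l < t × Covers l × ¬ Covers (suc l)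
      transition-point = transition Covers covers? t covers-0 ¬covers-t

    l : ℕ
    l = proj₁ transition-point

    l<t : l < t
    l<t = proj₁ (proj₂ transition-point)

    covers-l : Covers l
    covers-l = proj₁ (proj₂ (proj₂ transition-point))

    ¬covers-[1+l] : ¬ Covers (suc l)
    ¬covers-[1+l] = proj₂ (proj₂ (proj₂ transition-point))

    -- Fixing (1 + l) · B is normal in X and contains B but not X, so by maximality it is B.
    Fixing[1+l]⊆B : Fixing (suc l) ⊆ B
    Fixing[1+l]⊆B v v∈F =
      [ (λ FB⊆B → FB⊆B v (⊆-·ˡ (Fixing (suc l)) B B.id∈ v v∈F)) , (λ X⊆FB → contradiction X⊆FB ¬covers-[1+l]) ]
      (proj₂ (proj₂ B-max) (Fixing (suc l) · B) (FixingB-isNormalIn (suc l)) (⊆-·ʳ (Fixing (suc l)) B F-id∈))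
      where F-id∈ = PermGroup.id∈ (proj₁ (Fixing-isNormalIn (suc l)))

    j : Fin t
    j = fromℕ< l<t

    π : Arr n → Arr n
    π = restrict part j

    π-hom : IsHomOn π X
    π-hom = restrict-isHomOn part j X⊆L

    M : Sub n
    M = Fixing l

    C D : Sub n
    C = img π M
    D = img π (M ∩ B)

    ker-π⊆Fixing[1+l] : ∀ v → v ∈ M → π v ≡ idₚ → v ∈ Fixing (suc l)
    ker-π⊆Fixing[1+l] v v∈M πv≡id = Fixing-intro (suc l) v (Fixing-⊆ l v v∈M) fixes
      where
      fixes : ∀ i → toℕ i < suc l → restrict part i v ≡ idₚ
      fixes i i<1+l with toℕ i ℕ.<? l
      ... | yes i<l = Fixing-elim l v v∈M i i<l
      ... | no i≮l = subst (λ i → restrict part i v ≡ idₚ) (toℕ-injective (trans (toℕ-fromℕ< l<t) (sym i≡l))) πv≡id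
        where i≡l = ≤-antisym (≤-pred i<1+l) (≮⇒≥ i≮l)

    -- a chosen factorisation a = k · b with k ∈ M and b ∈ B
    M-factor : Arr n → Arr n
    M-factor a = choose (λ k → M k ∧ coset k B a)

    M-factor-spec : ∀ a → a ∈ X → M-factor a ∈ M × ∃ λ b → b ∈ B × M-factor a ∘ₚ b ≡ a
    M-factor-spec a a∈X =
      let (k , b , k∈M , b∈B , kb≡a) = ·-elim M B (covers-l a a∈X)
          chosen = choose-sound (λ k → M k ∧ coset k B a) k
                     (∧-intro {M k} k∈M (subst (_∈ coset k B) kb≡a (img-intro (k ∘ₚ_) B b∈B)))
      in ∧-elimˡ {M (M-factor a)} chosen , img-elim (M-factor a ∘ₚ_) B (∧-elimʳ {M (M-factor a)} chosen)

    φ : Arr n → Arr n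
    φ a = π (M-factor a)

    private
      module M = PermGroup (proj₁ (Fixing-isNormalIn l))
      M⊆X = Fixing-⊆ l

      k = M-factor
      k∈M : ∀ a → a ∈ X → k a ∈ M
      k∈M a a∈X = proj₁ (M-factor-spec a a∈X)
      b : ∀ a → a ∈ X → Arr n
      b a a∈X = proj₁ (proj₂ (M-factor-spec a a∈X))
      b∈B : ∀ a (a∈X : a ∈ X) → b a a∈X ∈ B
      b∈B a a∈X = proj₁ (proj₂ (proj₂ (M-factor-spec a a∈X)))
      kb≡a : ∀ a (a∈X : a ∈ X) → k a ∘ₚ b a a∈X ≡ a
      kb≡a a a∈X = proj₂ (proj₂ (proj₂ (M-factor-spec a a∈X)))

    φ∈C : ∀ a → a ∈ X → φ a ∈ C
    φ∈C a a∈X = img-intro π M (k∈M a a∈X)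

    -- k b · k' b' = k k' · b₃ b' where b k' = k' b₃; comparing with the chosen factorisation of a a'
    -- leaves a correction term in M ∩ B.
    φ-hom : ∀ a a' → a ∈ X → a' ∈ X → ∃ λ d → d ∈ D × φ (a ∘ₚ a') ≡ (φ a ∘ₚ φ a') ∘ₚ d
    φ-hom a a' a∈X a'∈X = π m , img-intro π (M ∩ B) (∧-intro {M m} m∈M m∈B) , (begin
      π (k (a ∘ₚ a'))             ≡⟨ cong π k''≡kk'm ⟩
      π ((k a ∘ₚ k a') ∘ₚ m)      ≡⟨ π-hom (k a ∘ₚ k a') m (M⊆X _ (M.∘∈ (k a) (k a') (k∈M a a∈X) (k∈M a' a'∈X))) (M⊆X m m∈M) ⟩
      π (k a ∘ₚ k a') ∘ₚ π m      ≡⟨ cong (_∘ₚ π m) (π-hom (k a) (k a') (M⊆X _ (k∈M a a∈X)) (M⊆X _ (k∈M a' a'∈X))) ⟩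
      (φ a ∘ₚ φ a') ∘ₚ π m        ∎)
      where
      aa'∈X = X.∘∈ a a' a∈X a'∈X
      commute = isNormalIn-swapʳ X-grp B-normal (k a') (b a a∈X) (M⊆X _ (k∈M a' a'∈X)) (b∈B a a∈X)
      b₃ = proj₁ commute
      b'' = b (a ∘ₚ a') aa'∈X
      b''⁻¹ = B.inv b'' (b∈B _ aa'∈X)
      m = (b₃ ∘ₚ b a' a'∈X) ∘ₚ b''⁻¹
      m∈B : m ∈ B
      m∈B = B.∘∈ (b₃ ∘ₚ b a' a'∈X) b''⁻¹ (B.∘∈ b₃ (b a' a'∈X) (proj₁ (proj₂ commute)) (b∈B a' a'∈X)) (B.inv∈ b'' (b∈B _ aa'∈X))
      kk'·b₃b'≡k''b'' : (k a ∘ₚ k a') ∘ₚ (b₃ ∘ₚ b a' a'∈X) ≡ k (a ∘ₚ a') ∘ₚ b''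
      kk'·b₃b'≡k''b'' = begin
        (k a ∘ₚ k a') ∘ₚ (b₃ ∘ₚ b')     ≡⟨ ∘ₚ-assoc (k a) (k a') (b₃ ∘ₚ b') ⟩
        k a ∘ₚ (k a' ∘ₚ (b₃ ∘ₚ b'))     ≡⟨ cong (k a ∘ₚ_) (∘ₚ-assoc (k a') b₃ b') ⟨
        k a ∘ₚ ((k a' ∘ₚ b₃) ∘ₚ b')     ≡⟨ cong (λ z → k a ∘ₚ (z ∘ₚ b')) (proj₂ (proj₂ commute)) ⟨
        k a ∘ₚ ((b a a∈X ∘ₚ k a') ∘ₚ b') ≡⟨ cong (k a ∘ₚ_) (∘ₚ-assoc (b a a∈X) (k a') b') ⟩
        k a ∘ₚ (b a a∈X ∘ₚ (k a' ∘ₚ b')) ≡⟨ ∘ₚ-assoc (k a) (b a a∈X) (k a' ∘ₚ b') ⟨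
        (k a ∘ₚ b a a∈X) ∘ₚ (k a' ∘ₚ b') ≡⟨ cong₂ _∘ₚ_ (kb≡a a a∈X) (kb≡a a' a'∈X) ⟩
        a ∘ₚ a'                          ≡⟨ kb≡a (a ∘ₚ a') aa'∈X ⟨
        k (a ∘ₚ a') ∘ₚ b''               ∎
        where b' = b a' a'∈X
      k''≡kk'm : k (a ∘ₚ a') ≡ (k a ∘ₚ k a') ∘ₚ m
      k''≡kk'm = begin
        k (a ∘ₚ a')                                 ≡⟨ ∘ₚ-cancelʳ-inverse (k (a ∘ₚ a')) b'' b''⁻¹ (B.inverseʳ b'' (b∈B _ aa'∈X)) ⟨
        (k (a ∘ₚ a') ∘ₚ b'') ∘ₚ b''⁻¹               ≡⟨ cong (_∘ₚ b''⁻¹) kk'·b₃b'≡k''b'' ⟨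
        ((k a ∘ₚ k a') ∘ₚ (b₃ ∘ₚ b a' a'∈X)) ∘ₚ b''⁻¹ ≡⟨ ∘ₚ-assoc (k a ∘ₚ k a') (b₃ ∘ₚ b a' a'∈X) b''⁻¹ ⟩
        (k a ∘ₚ k a') ∘ₚ m                          ∎
      m∈M : m ∈ M
      m∈M = M.right-factor∈ (k a ∘ₚ k a') (k (a ∘ₚ a')) m (M.∘∈ (k a) (k a') (k∈M a a∈X) (k∈M a' a'∈X)) (k∈M _ aa'∈X) k''≡kk'm

    -- If π (k a) = π n₀ with n₀ ∈ M ∩ B, then k a · n₀⁻¹ ∈ M fixes Δₗ as well, so lies in Fixing (1 + l) ⊆ B.
    φ-ker : ∀ a → a ∈ X → (φ a ∈ D → a ∈ B) × (a ∈ B → φ a ∈ D)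
    φ-ker a a∈X = φa∈D⇒a∈B , a∈B⇒φa∈D
      where
      φa∈D⇒a∈B : φ a ∈ D → a ∈ B
      φa∈D⇒a∈B φa∈D =
        let (n₀ , n₀∈M∩B , πn₀≡φa) = img-elim π (M ∩ B) φa∈D
            n₀∈M = ∧-elimˡ {M n₀} n₀∈M∩B
            n₀⁻¹ = M.inv n₀ n₀∈M
            n₀⁻¹∈X = M⊆X n₀⁻¹ (M.inv∈ n₀ n₀∈M)
            z = k a ∘ₚ n₀⁻¹
            πz≡id : π z ≡ idₚ
            πz≡id = begin
              π z               ≡⟨ π-hom (k a) n₀⁻¹ (M⊆X _ (k∈M a a∈X)) n₀⁻¹∈X ⟩
              π (k a) ∘ₚ π n₀⁻¹ ≡⟨ cong (_∘ₚ π n₀⁻¹) πn₀≡φa ⟨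
              π n₀ ∘ₚ π n₀⁻¹    ≡⟨ π-hom n₀ n₀⁻¹ (M⊆X n₀ n₀∈M) n₀⁻¹∈X ⟨
              π (n₀ ∘ₚ n₀⁻¹)    ≡⟨ cong π (M.inverseʳ n₀ n₀∈M) ⟩
              π idₚ             ≡⟨ restrict-idₚ part j ⟩
              idₚ               ∎
            z∈B = Fixing[1+l]⊆B z (ker-π⊆Fixing[1+l] z (M.∘∈ (k a) n₀⁻¹ (k∈M a a∈X) (M.inv∈ n₀ n₀∈M)) πz≡id)
            ka∈B = subst (_∈ B) (∘ₚ-cancelʳ-inverse (k a) n₀⁻¹ n₀ (M.inverseˡ n₀ n₀∈M)) (B.∘∈ z n₀ z∈B (∧-elimʳ {M n₀} n₀∈M∩B))
        in subst (_∈ B) (kb≡a a a∈X) (B.∘∈ (k a) (b a a∈X) ka∈B (b∈B a a∈X))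
      a∈B⇒φa∈D : a ∈ B → φ a ∈ D
      a∈B⇒φa∈D a∈B =
        let b⁻¹ = B.inv (b a a∈X) (b∈B a a∈X)
            ka≡ab⁻¹ = trans (sym (∘ₚ-cancelʳ-inverse (k a) (b a a∈X) b⁻¹ (B.inverseʳ _ (b∈B a a∈X)))) (cong (_∘ₚ b⁻¹) (kb≡a a a∈X))
        in img-intro π (M ∩ B) (∧-intro {M (k a)} (k∈M a a∈X)
             (subst (_∈ B) (sym ka≡ab⁻¹) (B.∘∈ a b⁻¹ a∈B (B.inv∈ _ (b∈B a a∈X)))))

    φ-onto : ∀ c → c ∈ C → ∃ λ a → a ∈ X × ∃ λ d → d ∈ D × c ≡ φ a ∘ₚ d
    φ-onto c c∈C =
      let (m , m∈M , πm≡c) = img-elim π M c∈C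
          m∈X = M⊆X m m∈M
          bm∈M = M.right-factor∈ (k m) m (b m m∈X) (k∈M m m∈X) m∈M (sym (kb≡a m m∈X))
      in m , m∈X , π (b m m∈X) , img-intro π (M ∩ B) (∧-intro {M (b m m∈X)} bm∈M (b∈B m m∈X)) ,
         (begin
           c                           ≡⟨ πm≡c ⟨
           π m                         ≡⟨ cong π (kb≡a m m∈X) ⟨
           π (k m ∘ₚ b m m∈X)          ≡⟨ π-hom (k m) (b m m∈X) (M⊆X _ (k∈M m m∈X)) (M⊆X _ bm∈M) ⟩
           φ m ∘ₚ π (b m m∈X)          ∎)

    quotIso : QuotIso X B C D
    quotIso = φ , φ∈C , φ-hom , φ-ker , φ-onto

    top-factor : ∃ λ i → ∃ λ C' → ∃ λ D' → CompFactor (induced part i X) C' D' × QuotIso X B C' D'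
    top-factor =
      let (C' , C'≐C , factor) = compFactor-normal C-isNormalIn (here D-maxNormal (compSeries (proj₁ D-isNormalIn)))
      in j , C' , D , factor , quotIso-≐ quotIso (swap C'≐C)
      where
      π-perm : ∀ x → x ∈ X → T (isPerm (π x))
      π-perm x x∈X = restrict-isPerm part j x (X⊆L x x∈X)
      M-grp = proj₁ (Fixing-isNormalIn l)
      C-isNormalIn : IsNormalIn C (img π X)
      C-isNormalIn = img-isNormalIn X-grp π π-hom (restrict-idₚ part j) π-perm (Fixing-isNormalIn l)
      D-isNormalIn : IsNormalIn D C
      D-isNormalIn = img-isNormalIn M-grp π (λ a b a∈M b∈M → π-hom a b (M⊆X a a∈M) (M⊆X b b∈M)) (restrict-idₚ part j)
                       (λ v v∈M → π-perm v (M⊆X v v∈M)) (∩-isNormalIn M-grp M⊆X B-normal)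
      D-maxNormal : MaxNormal D C
      D-maxNormal = Correspondence.maxNormal-quotIso X-grp (proj₁ C-isNormalIn) D-isNormalIn quotIso B-max

compFactor-induced : ∀ {n t} (part : Fin n → Fin t) {X A B : Sub n} → IsPermGroup X → X ⊆ YoungSub part → CompFactor X A B
                   → ∃ λ i → ∃ λ C → ∃ λ D → CompFactor (induced part i X) C D × QuotIso A B C D
compFactor-induced part X-grp X⊆L (here B-max _) = Transition.top-factor part X-grp X⊆L B-max
compFactor-induced part {X} X-grp X⊆L (there Y-max factor) =
  let Y⊆X = maxNormal-⊆ Y-max
      (i , C , D , Y-factor , iso) = compFactor-induced part (maxNormal-isPermGroup Y-max) (λ v v∈Y → X⊆L v (Y⊆X v v∈Y)) factor
      (C' , C'≐C , X-factor) = compFactor-normal (img-isNormalIn X-grp (restrict part i) (restrict-isHomOn part i X⊆L)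
                                 (restrict-idₚ part i) (λ x x∈X → restrict-isPerm part i x (X⊆L x x∈X)) (proj₁ Y-max)) Y-factor
  in i , C' , D , X-factor , quotIso-≐ iso (swap C'≐C)

lemma3p2 : (n : ℕ) → 5 ≤ n → (k : Kind) → (H : Sub n)
    → IsPermGroup H → H ⊆ groupOf k n
    → (∃ λ m → HasIndex (groupOf k n) H m × Odd m × 1 < m)
    → (t : ℕ) → 2 ≤ t → (part : Fin n → Fin t) → IsPartition part
    → Normalizes H (YoungSub part)
    → (OddIndex (YoungSub part ∩ groupOf k n) (YoungSub part ∩ H)
       × (∀ i → OddIndex (induced part i (YoungSub part ∩ groupOf k n))
                         (induced part i (YoungSub part ∩ H))))
      × (∀ A B → CompFactor (YoungSub part ∩ H) A B
           → ∃ λ i → ∃ λ C → ∃ λ D →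
               CompFactor (induced part i (YoungSub part ∩ H)) C D × QuotIso A B C D)
lemma3p2 n _ k H H-grp H⊆G (m , G≡mH , m-odd , _) t _ part _ H-normalizes-L =
  (L∩G:L∩H-odd , λ i → oddIndex-image L∩G-grp L∩H-grp L∩H⊆L∩G (restrict part i)
                         (restrict-isHomOn part i (λ v → ∧-elimˡ {L v})) (restrict-idₚ part i) L∩G:L∩H-odd) ,
  λ A B → compFactor-induced part L∩H-grp (λ v → ∧-elimˡ {L v})
  where
  L = YoungSub part
  G = groupOf k n
  L∩G-grp = ∩-isPermGroup (Young-isPermGroup part) (groupOf-isPermGroup k n)
  L∩H-grp = ∩-isPermGroup (Young-isPermGroup part) H-grp
  L∩H⊆L∩G : (L ∩ H) ⊆ (L ∩ G)
  L∩H⊆L∩G v v∈L∩H = ∧-intro {L v} (∧-elimˡ v∈L∩H) (H⊆G v (∧-elimʳ {L v} v∈L∩H))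
  L∩G:L∩H-odd = oddIndex-∩ (groupOf-isPermGroup k n) H-grp (Young-isPermGroup part) H⊆G H-normalizes-L (m , G≡mH , m-odd)
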